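{- Let $A,B\in\mathbb{C}$ with $B\neq 0$. Define polynomials $b_n(\lambda)\in\mathbb{C}[\lambda]$ by $b_{ -1}=0$, $b_0=1$ and $$b_{n+1}(\lambda)=\frac{1}{B(n+1)^2}\Bigl(\bigl(\lambda-An(n+1)\bigr)b_n(\lambda)-n^2 b_{n-1}(\lambda)\Bigr),\qquad n\ge 0.$$ Then $b_n$ has degree exactly $n$, so $\{b_m\}_{m\ge0}$ is a basis of $\mathbb{C}[\lambda]$ and there are unique numbers $c_{klm}\in\mathbb{C}$ (with $c_{klm}=0$ for $m>k+l$) such that $b_k(\lambda)b_l(\lambda)=\sum_{m\ge 0}c_{klm}b_m(\lambda)$ for all $k,l\ge0$. Let $$P(x,y,z)=(B-xy-yz-xz)^2-4xyz\,(x+y+z+A),$$ which equals the discriminant in $t$ of $f(t)-(t-x)(t-y)(t-z)$ with $f(t)=t^3+At^2+Bt$. Then, as formal power series in $x,y,z$, $$\sum_{k,l,m\ge 0}c_{klm}\,x^ky^lz^m \;=\; B\cdot P(x,y,Bz)^{ -1/2},$$ where $P(x,y,Bz)^{ -1/2}$ denotes the formal power series whose square is $P(x,y,Bz)^{ -1}$ and whose constant term is $1/B$.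
   Context: The series $\varphi_\lambda(t)=\sum_{n\ge0}b_n(\lambda)t^n$ is the normalized ($\varphi_\lambda(0)=1$) power series solution at $t=0$ of the "D2" equation $\mathcal{L}\varphi=\lambda\varphi$, where $\mathcal{L}=f(t)\partial_t^2+f'(t)\partial_t+t$ and $f(t)=t^3+At^2+Bt$; $\lambda$ is the accessory parameter. -}

module Defs where

open import Level using (Level; _⊔_) renaming (suc to lsuc)
open import Data.Nat using (ℕ; zero; suc; _∸_; _<_) renaming (_+_ to _+ℕ_; _*_ to _*ℕ_)
open import Relation.Nullary using (¬_)
open import Algebra.Bundles using (CommutativeRing)

-- A field of characteristic zero: a commutative ring in which every
-- nonzero element has a multiplicative inverse and n+1 ≠ 0 for all n ∈ ℕ
-- (the latter also gives 1 ≠ 0).  (agda-stdlib has no Field bundle and no ℂ.)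
-- canonical image of a natural number: ι n = 1 + 1 + ... + 1 (n times)
ιᴿ : {c ℓ : Level} (R : CommutativeRing c ℓ) → ℕ → CommutativeRing.Carrier R
ιᴿ R zero    = CommutativeRing.0# R
ιᴿ R (suc n) = CommutativeRing._+_ R (CommutativeRing.1# R) (ιᴿ R n)

record CharZeroField (c ℓ : Level) : Set (lsuc (c ⊔ ℓ)) where
  field
    commRing : CommutativeRing c ℓ
  open CommutativeRing commRing public
  ι : ℕ → Carrier
  ι = ιᴿ commRing
  field
    inv   : (x : Carrier) → ¬ (x ≈ 0#) → Carrier
    inv-r : (x : Carrier) (p : ¬ (x ≈ 0#)) → x * inv x p ≈ 1#
    char0 : (n : ℕ) → ¬ (ι (suc n) ≈ 0#)

module Setup {c ℓ : Level} (K : CharZeroField c ℓ)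
             (A B : CharZeroField.Carrier K)
             (hB : ¬ (CharZeroField._≈_ K B (CharZeroField.0# K))) where
  open CharZeroField K

  Σ≤ : ℕ → (ℕ → Carrier) → Carrier
  Σ≤ zero    f = f 0
  Σ≤ (suc n) f = Σ≤ n f + f (suc n)

  -- Polynomials in λ, represented by their coefficient sequences:
  -- p j is the coefficient of λ^j (finitely supported in use).
  Poly : Set c
  Poly = ℕ → Carrier

  _≈ᴾ_ : Poly → Poly → Set ℓ
  p ≈ᴾ q = (j : ℕ) → p j ≈ q j

  _·ᴾ_ : Poly → Poly → Poly
  (p ·ᴾ q) j = Σ≤ j (λ i → p i * q (j ∸ i))

  zeroᴾ oneᴾ : Poly
  zeroᴾ _       = 0#
  oneᴾ zero     = 1#
  oneᴾ (suc _)  = 0#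

  -- multiplication by λ
  shiftᴾ : Poly → Poly
  shiftᴾ p zero    = 0#
  shiftᴾ p (suc j) = p j

  -- b_{n+1} = (1/(B (n+1)^2)) ((λ - A n (n+1)) b_n - n^2 b_{n-1}),
  -- here: step n bₙ bₙ₋₁ ;  note suc n *ℕ suc n = suc (n + n * suc n).
  step : ℕ → Poly → Poly → Poly
  step n bn bn₋₁ j =
    (inv B hB * inv (ι (suc n *ℕ suc n)) (char0 (n +ℕ n *ℕ suc n)))
      * ((shiftᴾ bn j + - (A * ι (n *ℕ suc n) * bn j)) + - (ι (n *ℕ n) * bn₋₁ j))

  b : ℕ → Poly
  b zero          = oneᴾ
  b (suc zero)    = step 0 (b 0) zeroᴾ
  b (suc (suc n)) = step (suc n) (b (suc n)) (b n)

  HasDegree : Poly → ℕ → Set ℓ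
  HasDegree p n = (¬ (p n ≈ 0#)) × ((j : ℕ) → n < j → p j ≈ 0#)
    where open import Data.Product using (_×_)

  IsStructConst : (ℕ → ℕ → ℕ → Carrier) → Set ℓ
  IsStructConst cf =
    ((k l m : ℕ) → k +ℕ l < m → cf k l m ≈ 0#) ×
    ((k l : ℕ) → (b k ·ᴾ b l) ≈ᴾ (λ j → Σ≤ (k +ℕ l) (λ m → cf k l m * b m j)))
    where open import Data.Product using (_×_)

  -- Formal power series in x, y, z: F k l m = coefficient of x^k y^l z^m.
  Ser : Set c
  Ser = ℕ → ℕ → ℕ → Carrier

  _≈ˢ_ : Ser → Ser → Set ℓ
  F ≈ˢ G = (k l m : ℕ) → F k l m ≈ G k l m

  _⊕_ _⊛_ : Ser → Ser → Ser
  (F ⊕ G) k l m = F k l m + G k l m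
  (F ⊛ G) k l m =
    Σ≤ k (λ a → Σ≤ l (λ b' → Σ≤ m (λ c' →
      F a b' c' * G (k ∸ a) (l ∸ b') (m ∸ c'))))

  ⊝_ : Ser → Ser
  (⊝ F) k l m = - F k l m

  _⊖_ : Ser → Ser → Ser
  F ⊖ G = F ⊕ (⊝ G)

  _•_ : Carrier → Ser → Ser
  (a • F) k l m = a * F k l m

  cst : Carrier → Ser
  cst a zero zero zero = a
  cst a _    _    _    = 0#

  X Y Z : Ser
  X (suc zero) zero zero = 1#
  X _ _ _ = 0#
  Y zero (suc zero) zero = 1#
  Y _ _ _ = 0#
  Z zero zero (suc zero) = 1#
  Z _ _ _ = 0#

  P[x,y,Bz] : Ser
  P[x,y,Bz] =
    let W = B • Z
        Q = ((cst B ⊖ (X ⊛ Y)) ⊖ (Y ⊛ W)) ⊖ (X ⊛ W)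
    in (Q ⊛ Q) ⊖ (ι 4 • (((X ⊛ Y) ⊛ W) ⊛ (((X ⊕ Y) ⊕ W) ⊕ cst A)))

-- The bₙ have degree n with nonzero leading coefficient, so they form a triangular basis and the
-- structure constants c_klm exist and are unique.  Multiplying b_k b_l = Σₘ c_klm bₘ by λ, and
-- expanding λ b_k and λ bₘ with λ bₙ = B (n+1)² bₙ₊₁ + A n(n+1) bₙ + n² bₙ₋₁, shows that
--   B (k+1)² c_{k+1,l,m} + A k(k+1) c_{k,l,m} + k² c_{k-1,l,m}
--     = (m+1)² c_{k,l,m+1} + A m(m+1) c_{k,l,m} + B m² c_{k,l,m-1},
-- a recurrence in k that determines c from c_{0,l,m} = δ_lm, because B (k+1)² ≠ 0.
-- The series S = P(x,y,Bz)^{-1/2} satisfies 𝓛ₓ S = 𝓛_z S for the D2 operators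
-- 𝓛ₓ = f ∂ₓ² + f′ ∂ₓ + x and 𝓛_z = g ∂_z² + g′ ∂_z + B z, where g(z) = B z³ + A z² + z:
-- 4 P² (𝓛ₓ − 𝓛_z) S is a combination of the first two x- and z-derivatives of S² P = 1 and of a
-- differential polynomial in P that vanishes identically.  On coefficients this is the same
-- recurrence for B S, and at x = 0 we get B S = 1/(1 − y z), whose coefficients are δ_lm.

module Submission where

open import Defs
open import Level using (Level; _⊔_)
open import Algebra.Bundles using (CommutativeRing)
open import Algebra.Morphism.Bundles using (RingHomomorphism)
open import Algebra.Morphism.Construct.Composition using (ringHomomorphism)
open import Data.Fin using (Fin; #_)
open import Data.Integer as ℤ using (ℤ; +_; -[1+_])
import Data.Integer.Properties as ℤₚ
open import Data.Maybe using (nothing)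
open import Data.Nat as ℕ using (ℕ; zero; suc; _∸_; _≤_; _<_; z≤n; s≤s)
import Data.Nat.Properties as ℕₚ
open import Data.Product using (_×_; _,_; proj₁; proj₂; ∃)
open import Data.Sum using (inj₁; inj₂; [_,_]′)
open import Data.Vec using (Vec; _∷_; []; lookup; map)
open import Data.Vec.Properties using (lookup-map)
open import Relation.Nullary using (¬_; yes; no; contradiction)
open import Relation.Binary.PropositionalEquality as ≡ using (_≡_)
open import Tactic.RingSolver.Core.AlmostCommutativeRing using (fromCommutativeRing)
open import Tactic.RingSolver.Core.Polynomial.Parameters using (Homomorphism)
import Tactic.RingSolver.Core.Expression as Expression
open Expression using (Expr)

module ℤSolver {c ℓ : Level} (R : CommutativeRing c ℓ) where
  open CommutativeRing R
  open Expression using (Κ; Ι; _⊕_; _⊗_; _⊛_; ⊝_; module Eval)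
  open import Data.Bool using (Bool; true; false; T)
  open import Relation.Binary.Reasoning.Setoid setoid
  open import Algebra.Properties.Ring ring
    using (-‿distribˡ-*; -‿distribʳ-*; -‿involutive; -‿+-comm; -0#≈0#)
  open import Algebra.Properties.CommutativeSemigroup +-commutativeSemigroup using (x∙yz≈y∙xz)

  ι : ℕ → Carrier
  ι = ιᴿ R

  ι-+ : ∀ m n → ι (m ℕ.+ n) ≈ ι m + ι n
  ι-+ zero    n = sym (+-identityˡ _)
  ι-+ (suc m) n = trans (+-congˡ (ι-+ m n)) (sym (+-assoc _ _ _))

  ι-* : ∀ m n → ι (m ℕ.* n) ≈ ι m * ι n
  ι-* zero    n = sym (zeroˡ _)
  ι-* (suc m) n = begin
    ι (n ℕ.+ m ℕ.* n)      ≈⟨ ι-+ n (m ℕ.* n) ⟩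
    ι n + ι (m ℕ.* n)      ≈⟨ +-cong (sym (*-identityˡ _)) (ι-* m n) ⟩
    1# * ι n + ι m * ι n   ≈⟨ distribʳ _ _ _ ⟨
    (1# + ι m) * ι n       ∎

  private
    ⟦_⟧ᵢ : ℤ → Carrier
    ⟦ + n      ⟧ᵢ = ι n
    ⟦ -[1+ n ] ⟧ᵢ = - ι (suc n)

    ⟦⟧ᵢ-neg : ∀ i → ⟦ ℤ.- i ⟧ᵢ ≈ - ⟦ i ⟧ᵢ
    ⟦⟧ᵢ-neg (+ zero)  = sym -0#≈0#
    ⟦⟧ᵢ-neg (+ suc n) = refl
    ⟦⟧ᵢ-neg -[1+ n ]  = sym (-‿involutive _)

    ⟦⟧ᵢ-⊖ : ∀ m n → ⟦ m ℤ.⊖ n ⟧ᵢ ≈ ι m - ι n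
    ⟦⟧ᵢ-⊖ zero    zero    = sym (-‿inverseʳ 0#)
    ⟦⟧ᵢ-⊖ (suc m) zero    = sym (trans (+-congˡ -0#≈0#) (+-identityʳ _))
    ⟦⟧ᵢ-⊖ zero    (suc n) = sym (+-identityˡ _)
    ⟦⟧ᵢ-⊖ (suc m) (suc n) = begin
      ⟦ suc m ℤ.⊖ suc n ⟧ᵢ          ≡⟨ ≡.cong ⟦_⟧ᵢ (ℤₚ.[1+m]⊖[1+n]≡m⊖n m n) ⟩
      ⟦ m ℤ.⊖ n ⟧ᵢ                  ≈⟨ ⟦⟧ᵢ-⊖ m n ⟩
      ι m - ι n                      ≈⟨ +-identityˡ _ ⟨
      0# + (ι m - ι n)               ≈⟨ +-congʳ (-‿inverseʳ 1#) ⟨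
      (1# - 1#) + (ι m - ι n)        ≈⟨ +-assoc _ _ _ ⟩
      1# + (- 1# + (ι m - ι n))      ≈⟨ +-congˡ (x∙yz≈y∙xz _ _ _) ⟩
      1# + (ι m + (- 1# - ι n))      ≈⟨ +-assoc _ _ _ ⟨
      (1# + ι m) + (- 1# - ι n)      ≈⟨ +-congˡ (-‿+-comm 1# (ι n)) ⟩
      (1# + ι m) - (1# + ι n)        ∎

    ⟦⟧ᵢ-+ : ∀ i j → ⟦ i ℤ.+ j ⟧ᵢ ≈ ⟦ i ⟧ᵢ + ⟦ j ⟧ᵢ
    ⟦⟧ᵢ-+ -[1+ m ] -[1+ n ] = begin
      - (1# + ι (suc (m ℕ.+ n)))     ≈⟨ -‿cong (+-congˡ (ι-+ (suc m) n)) ⟩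
      - (1# + (ι (suc m) + ι n))     ≈⟨ -‿cong (x∙yz≈y∙xz _ _ _) ⟩
      - (ι (suc m) + (1# + ι n))     ≈⟨ -‿+-comm _ _ ⟨
      - ι (suc m) - ι (suc n)        ∎
    ⟦⟧ᵢ-+ -[1+ m ] (+ n)    = trans (⟦⟧ᵢ-⊖ n (suc m)) (+-comm _ _)
    ⟦⟧ᵢ-+ (+ m)    -[1+ n ] = ⟦⟧ᵢ-⊖ m (suc n)
    ⟦⟧ᵢ-+ (+ m)    (+ n)    = ι-+ m n

    ⟦⟧ᵢ-+* : ∀ m j → ⟦ + m ℤ.* j ⟧ᵢ ≈ ι m * ⟦ j ⟧ᵢ
    ⟦⟧ᵢ-+* m (+ n)    = trans (reflexive (≡.cong ⟦_⟧ᵢ (≡.sym (ℤₚ.pos-* m n)))) (ι-* m n)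
    ⟦⟧ᵢ-+* m -[1+ n ] = begin
      ⟦ + m ℤ.* -[1+ n ] ⟧ᵢ          ≡⟨ ≡.cong ⟦_⟧ᵢ (ℤₚ.neg-distribʳ-* (+ m) (+ suc n)) ⟨
      ⟦ ℤ.- (+ m ℤ.* + suc n) ⟧ᵢ     ≈⟨ ⟦⟧ᵢ-neg (+ m ℤ.* + suc n) ⟩
      - ⟦ + m ℤ.* + suc n ⟧ᵢ         ≈⟨ -‿cong (⟦⟧ᵢ-+* m (+ suc n)) ⟩
      - (ι m * ι (suc n))            ≈⟨ -‿distribʳ-* _ _ ⟩
      ι m * - ι (suc n)              ∎

    ⟦⟧ᵢ-* : ∀ i j → ⟦ i ℤ.* j ⟧ᵢ ≈ ⟦ i ⟧ᵢ * ⟦ j ⟧ᵢ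
    ⟦⟧ᵢ-* (+ m)    j = ⟦⟧ᵢ-+* m j
    ⟦⟧ᵢ-* -[1+ m ] j = begin
      ⟦ -[1+ m ] ℤ.* j ⟧ᵢ            ≡⟨ ≡.cong ⟦_⟧ᵢ (ℤₚ.neg-distribˡ-* (+ suc m) j) ⟨
      ⟦ ℤ.- (+ suc m ℤ.* j) ⟧ᵢ       ≈⟨ ⟦⟧ᵢ-neg (+ suc m ℤ.* j) ⟩
      - ⟦ + suc m ℤ.* j ⟧ᵢ           ≈⟨ -‿cong (⟦⟧ᵢ-+* (suc m) j) ⟩
      - (ι (suc m) * ⟦ j ⟧ᵢ)         ≈⟨ -‿distribˡ-* _ _ ⟩
      - ι (suc m) * ⟦ j ⟧ᵢ           ∎

  -- The solver interprets integer constants by numerals, for which ⟦ + 1 ⟧ℤ is 1#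
  -- on the nose, so that solver statements match goals containing 1# literally.
  numeral : ℕ → Carrier
  numeral zero          = 0#
  numeral (suc zero)    = 1#
  numeral (suc (suc n)) = 1# + numeral (suc n)

  numeral≈ι : ∀ n → numeral n ≈ ι n
  numeral≈ι zero          = refl
  numeral≈ι (suc zero)    = sym (+-identityʳ _)
  numeral≈ι (suc (suc n)) = +-congˡ (numeral≈ι (suc n))

  ⟦_⟧ℤ : ℤ → Carrier
  ⟦ + n      ⟧ℤ = numeral n
  ⟦ -[1+ n ] ⟧ℤ = - numeral (suc n)

  private
    ⟦⟧ℤ≈⟦⟧ᵢ : ∀ i → ⟦ i ⟧ℤ ≈ ⟦ i ⟧ᵢ
    ⟦⟧ℤ≈⟦⟧ᵢ (+ n)    = numeral≈ι n
    ⟦⟧ℤ≈⟦⟧ᵢ -[1+ n ] = -‿cong (numeral≈ι (suc n))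

    isZero : ℤ → Bool
    isZero (+ zero) = true
    isZero _        = false

    isZero-sound : ∀ i → T (isZero i) → 0# ≈ ⟦ i ⟧ℤ
    isZero-sound (+ zero) _ = refl

    ℤ-homomorphism : Homomorphism _ _ c ℓ
    ℤ-homomorphism = record
      { from = record { rawRing = ℤ.+-*-rawRing ; isZero = isZero }
      ; to = fromCommutativeRing R (λ _ → nothing)
      ; morphism = record
        { ⟦_⟧ = ⟦_⟧ℤ
        ; +-homo = λ i j → trans (⟦⟧ℤ≈⟦⟧ᵢ (i ℤ.+ j)) (trans (⟦⟧ᵢ-+ i j) (+-cong (sym (⟦⟧ℤ≈⟦⟧ᵢ i)) (sym (⟦⟧ℤ≈⟦⟧ᵢ j))))
        ; *-homo = λ i j → trans (⟦⟧ℤ≈⟦⟧ᵢ (i ℤ.* j)) (trans (⟦⟧ᵢ-* i j) (*-cong (sym (⟦⟧ℤ≈⟦⟧ᵢ i)) (sym (⟦⟧ℤ≈⟦⟧ᵢ j))))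
        ; -‿homo = λ i → trans (⟦⟧ℤ≈⟦⟧ᵢ (ℤ.- i)) (trans (⟦⟧ᵢ-neg i) (-‿cong (sym (⟦⟧ℤ≈⟦⟧ᵢ i))))
        ; 0-homo = refl
        ; 1-homo = refl
        }
      ; Zero-C⟶Zero-R = isZero-sound
      }

  open Eval rawRing ⟦_⟧ℤ public
  open import Tactic.RingSolver.Core.Polynomial.Base (Homomorphism.from ℤ-homomorphism)
    using (Poly; κ; _⊞_; _⊠_; ⊟_; _⊡_) renaming (ι to ιₚ)
  open import Tactic.RingSolver.Core.Polynomial.Homomorphism ℤ-homomorphism
    using (κ-hom; ι-hom; ⊞-hom; ⊠-hom; ⊟-hom; ⊡-hom)
  open import Tactic.RingSolver.Core.Polynomial.Semantics ℤ-homomorphism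
    using () renaming (⟦_⟧ to ⟦_⟧ₚ)
  open import Algebra.Properties.Semiring.Exp.TCOptimised semiring using (^-congˡ)

  private
    norm : ∀ {n} → Expr ℤ n → Poly n
    norm (Κ x)   = κ x
    norm (Ι x)   = ιₚ x
    norm (x ⊕ y) = norm x ⊞ norm y
    norm (x ⊗ y) = norm x ⊠ norm y
    norm (⊝ x)   = ⊟ norm x
    norm (x ⊛ i) = norm x ⊡ i

    ⟦_⇓⟧ : ∀ {n} → Expr ℤ n → _ → Carrier
    ⟦ expr ⇓⟧ = ⟦ norm expr ⟧ₚ

    correct : ∀ {n} (expr : Expr ℤ n) ρ → ⟦ expr ⇓⟧ ρ ≈ ⟦ expr ⟧ ρ
    correct (Κ x)   ρ = κ-hom x ρ
    correct (Ι x)   ρ = ι-hom x ρ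
    correct (x ⊕ y) ρ = trans (⊞-hom (norm x) (norm y) ρ) (+-cong (correct x ρ) (correct y ρ))
    correct (x ⊗ y) ρ = trans (⊠-hom (norm x) (norm y) ρ) (*-cong (correct x ρ) (correct y ρ))
    correct (⊝ x)   ρ = trans (⊟-hom (norm x) ρ) (-‿cong (correct x ρ))
    correct (x ⊛ i) ρ = trans (⊡-hom (norm x) i ρ) (^-congˡ i (correct x ρ))

  open import Relation.Binary.Reflection setoid Ι ⟦_⟧ ⟦_⇓⟧ correct public

module FiniteSums {c ℓ : Level} (R : CommutativeRing c ℓ) where
  open CommutativeRing R
  open import Relation.Binary.Reasoning.Setoid setoid
  open import Algebra.Properties.Ring ring using (-‿+-comm)
  open import Algebra.Properties.CommutativeSemigroup +-commutativeSemigroup using (interchange)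

  Σ : ℕ → (ℕ → Carrier) → Carrier
  Σ zero    f = f 0
  Σ (suc n) f = Σ n f + f (suc n)

  Σ-cong : ∀ n {f g} → (∀ i → f i ≈ g i) → Σ n f ≈ Σ n g
  Σ-cong zero    e = e 0
  Σ-cong (suc n) e = +-cong (Σ-cong n e) (e (suc n))

  Σ-cong≤ : ∀ n {f g} → (∀ i → i ≤ n → f i ≈ g i) → Σ n f ≈ Σ n g
  Σ-cong≤ zero    e = e 0 z≤n
  Σ-cong≤ (suc n) e = +-cong (Σ-cong≤ n (λ i i≤n → e i (ℕₚ.m≤n⇒m≤1+n i≤n))) (e (suc n) ℕₚ.≤-refl)

  Σ-zero : ∀ n {f} → (∀ i → f i ≈ 0#) → Σ n f ≈ 0#
  Σ-zero zero    e = e 0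
  Σ-zero (suc n) e = trans (+-cong (Σ-zero n e) (e (suc n))) (+-identityˡ _)

  Σ-+ : ∀ n f g → Σ n (λ i → f i + g i) ≈ Σ n f + Σ n g
  Σ-+ zero    f g = refl
  Σ-+ (suc n) f g = trans (+-congʳ (Σ-+ n f g)) (interchange _ _ _ _)

  Σ-neg : ∀ n f → - Σ n f ≈ Σ n (λ i → - f i)
  Σ-neg zero    f = refl
  Σ-neg (suc n) f = trans (sym (-‿+-comm _ _)) (+-congʳ (Σ-neg n f))

  Σ-*ˡ : ∀ n a f → a * Σ n f ≈ Σ n (λ i → a * f i)
  Σ-*ˡ zero    a f = refl
  Σ-*ˡ (suc n) a f = trans (distribˡ _ _ _) (+-congʳ (Σ-*ˡ n a f))

  Σ-*ʳ : ∀ n a f → Σ n f * a ≈ Σ n (λ i → f i * a)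
  Σ-*ʳ n a f = trans (*-comm _ _) (trans (Σ-*ˡ n a f) (Σ-cong n (λ i → *-comm _ _)))

  Σ-split-first : ∀ n f → Σ (suc n) f ≈ f 0 + Σ n (λ i → f (suc i))
  Σ-split-first zero    f = refl
  Σ-split-first (suc n) f = trans (+-congʳ (Σ-split-first n f)) (+-assoc _ _ _)

  Σ-reverse : ∀ n f → Σ n f ≈ Σ n (λ i → f (n ∸ i))
  Σ-reverse zero    f = refl
  Σ-reverse (suc n) f = begin
    Σ n f + f (suc n)                        ≈⟨ +-comm _ _ ⟩
    f (suc n) + Σ n f                        ≈⟨ +-congˡ (Σ-reverse n f) ⟩
    f (suc n) + Σ n (λ i → f (n ∸ i))        ≈⟨ Σ-split-first n (λ i → f (suc n ∸ i)) ⟨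
    Σ (suc n) (λ i → f (suc n ∸ i))          ∎

  Σ-antidiagonal : ∀ n (h : ℕ → ℕ → Carrier) →
    Σ n (λ i → Σ (n ∸ i) (h i)) ≈ Σ n (λ k → Σ k (λ i → h i (k ∸ i)))
  Σ-antidiagonal zero    h = refl
  Σ-antidiagonal (suc n) h = begin
    Σ (suc n) (λ i → Σ (suc n ∸ i) (h i))
      ≈⟨ Σ-split-first n _ ⟩
    Σ (suc n) (h 0) + Σ n (λ i → Σ (n ∸ i) (h (suc i)))
      ≈⟨ +-cong (Σ-split-first n (h 0)) (Σ-antidiagonal n (λ i → h (suc i))) ⟩
    (h 0 0 + Σ n (λ k → h 0 (suc k))) + Σ n (λ k → Σ k (λ i → h (suc i) (k ∸ i)))
      ≈⟨ trans (+-assoc _ _ _) (+-congˡ (sym (Σ-+ n _ _))) ⟩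
    h 0 0 + Σ n (λ k → h 0 (suc k) + Σ k (λ i → h (suc i) (k ∸ i)))
      ≈⟨ +-congˡ (Σ-cong n (λ k → Σ-split-first k (λ i → h i (suc k ∸ i)))) ⟨
    h 0 0 + Σ n (λ k → Σ (suc k) (λ i → h i (suc k ∸ i)))
      ≈⟨ Σ-split-first n _ ⟨
    Σ (suc n) (λ k → Σ k (λ i → h i (k ∸ i)))
      ∎

record Derivation {c ℓ : Level} (R : CommutativeRing c ℓ) : Set (c ⊔ ℓ) where
  open CommutativeRing R
  field
    d      : Carrier → Carrier
    d-cong : ∀ {a b} → a ≈ b → d a ≈ d b
    d-+    : ∀ a b → d (a + b) ≈ d a + d b
    d-*    : ∀ a b → d (a * b) ≈ d a * b + a * d b

  open import Algebra.Properties.Ring ring using (x+x≈x⇒x≈0; +-inverseʳ-unique)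
  open ℤSolver R using (ι)

  d-0# : d 0# ≈ 0#
  d-0# = x+x≈x⇒x≈0 _ (trans (sym (d-+ 0# 0#)) (d-cong (+-identityʳ 0#)))

  d-1# : d 1# ≈ 0#
  d-1# = x+x≈x⇒x≈0 _ (trans (sym (+-cong (*-identityʳ _) (*-identityˡ _)))
                          (trans (sym (d-* 1# 1#)) (d-cong (*-identityʳ 1#))))

  d-neg : ∀ a → d (- a) ≈ - d a
  d-neg a = +-inverseʳ-unique (d a) (d (- a)) (trans (sym (d-+ a (- a))) (trans (d-cong (-‿inverseʳ a)) d-0#))

  d-ι : ∀ n → d (ι n) ≈ 0#
  d-ι zero    = d-0#
  d-ι (suc n) = trans (d-+ _ _) (trans (+-cong d-1# (d-ι n)) (+-identityˡ _))

module PowerSeries {c ℓ : Level} (R : CommutativeRing c ℓ) where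
  open CommutativeRing R
  open import Relation.Binary.Reasoning.Setoid setoid
  open import Algebra.Properties.Ring ring using (-0#≈0#)
  open FiniteSums R public
  open ℤSolver R using (ι; ι-+; solve; _⊜_)
  open Expression using (_⊗_)

  Series : Set c
  Series = ℕ → Carrier

  infix 4 _≋_
  _≋_ : Series → Series → Set ℓ
  F ≋ G = ∀ n → F n ≈ G n

  infixl 6 _⊹_
  infixl 7 _⊠_
  _⊹_ _⊠_ : Series → Series → Series
  (F ⊹ G) n = F n + G n
  (F ⊠ G) n = Σ n (λ i → F i * G (n ∸ i))

  ⊟_ : Series → Series
  (⊟ F) n = - F n

  const : Carrier → Series
  const a zero    = a
  const a (suc _) = 0#

  𝟘 𝟙 : Series
  𝟘 _ = 0#
  𝟙 = const 1#

  ⊠-cong : ∀ {F F′ G G′} → F ≋ F′ → G ≋ G′ → F ⊠ G ≋ F′ ⊠ G′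
  ⊠-cong e e′ n = Σ-cong n (λ i → *-cong (e i) (e′ (n ∸ i)))

  ⊠-comm : ∀ F G → F ⊠ G ≋ G ⊠ F
  ⊠-comm F G n = begin
    Σ n (λ i → F i * G (n ∸ i))                  ≈⟨ Σ-reverse n _ ⟩
    Σ n (λ i → F (n ∸ i) * G (n ∸ (n ∸ i)))      ≈⟨ Σ-cong≤ n (λ i i≤n → trans (*-comm _ _)
                                                      (*-congʳ (reflexive (≡.cong G (ℕₚ.m∸[m∸n]≡n i≤n))))) ⟩
    Σ n (λ i → G i * F (n ∸ i))                  ∎

  ⊠-assoc : ∀ F G H → (F ⊠ G) ⊠ H ≋ F ⊠ (G ⊠ H)
  ⊠-assoc F G H n = begin
    Σ n (λ k → Σ k (λ i → F i * G (k ∸ i)) * H (n ∸ k))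
      ≈⟨ Σ-cong n (λ k → Σ-*ʳ k _ _) ⟩
    Σ n (λ k → Σ k (λ i → F i * G (k ∸ i) * H (n ∸ k)))
      ≈⟨ Σ-cong≤ n (λ k k≤n → Σ-cong≤ k (λ i i≤k →
           trans (*-assoc _ _ _) (*-congˡ (*-congˡ (reflexive (≡.cong H (∸-∸ i k i≤k))))))) ⟩
    Σ n (λ k → Σ k (λ i → F i * (G (k ∸ i) * H ((n ∸ i) ∸ (k ∸ i)))))
      ≈⟨ Σ-antidiagonal n (λ i j → F i * (G j * H ((n ∸ i) ∸ j))) ⟨
    Σ n (λ i → Σ (n ∸ i) (λ j → F i * (G j * H ((n ∸ i) ∸ j))))
      ≈⟨ Σ-cong n (λ i → Σ-*ˡ (n ∸ i) _ _) ⟨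
    Σ n (λ i → F i * Σ (n ∸ i) (λ j → G j * H ((n ∸ i) ∸ j)))
      ∎
    where
    ∸-∸ : ∀ i k → i ≤ k → n ∸ k ≡ (n ∸ i) ∸ (k ∸ i)
    ∸-∸ i k i≤k = ≡.trans (≡.cong (n ∸_) (≡.sym (ℕₚ.m+[n∸m]≡n i≤k))) (≡.sym (ℕₚ.∸-+-assoc n i (k ∸ i)))

  const-⊠ : ∀ a F → const a ⊠ F ≋ (λ n → a * F n)
  const-⊠ a F zero    = refl
  const-⊠ a F (suc n) = begin
    Σ (suc n) (λ i → const a i * F (suc n ∸ i))   ≈⟨ Σ-split-first n _ ⟩
    a * F (suc n) + Σ n (λ i → 0# * F (n ∸ i))    ≈⟨ +-congˡ (Σ-zero n (λ i → zeroˡ _)) ⟩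
    a * F (suc n) + 0#                            ≈⟨ +-identityʳ _ ⟩
    a * F (suc n)                                 ∎

  ⊠-identityˡ : ∀ F → 𝟙 ⊠ F ≋ F
  ⊠-identityˡ F n = trans (const-⊠ 1# F n) (*-identityˡ _)

  seriesRing : CommutativeRing c ℓ
  seriesRing = record
    { Carrier = Series ; _≈_ = _≋_ ; _+_ = _⊹_ ; _*_ = _⊠_ ; -_ = ⊟_ ; 0# = 𝟘 ; 1# = 𝟙
    ; isCommutativeRing = record
      { isRing = record
        { +-isAbelianGroup = record
          { isGroup = record
            { isMonoid = record
              { isSemigroup = record
                { isMagma = record
                  { isEquivalence = record
                    { refl = λ n → refl ; sym = λ e n → sym (e n) ; trans = λ e e′ n → trans (e n) (e′ n) }
                  ; ∙-cong = λ e e′ n → +-cong (e n) (e′ n) }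
                ; assoc = λ F G H n → +-assoc _ _ _ }
              ; identity = (λ F n → +-identityˡ _) , (λ F n → +-identityʳ _) }
            ; inverse = (λ F n → -‿inverseˡ _) , (λ F n → -‿inverseʳ _)
            ; ⁻¹-cong = λ e n → -‿cong (e n) }
          ; comm = λ F G n → +-comm _ _ }
        ; *-cong = ⊠-cong
        ; *-assoc = ⊠-assoc
        ; *-identity = ⊠-identityˡ , (λ F n → trans (⊠-comm F 𝟙 n) (⊠-identityˡ F n))
        ; distrib = (λ F G H n → trans (Σ-cong n (λ i → distribˡ _ _ _)) (Σ-+ n _ _))
                  , (λ F G H n → trans (Σ-cong n (λ i → distribʳ _ _ _)) (Σ-+ n _ _)) }
      ; *-comm = ⊠-comm } }

  Σ-coeff : ∀ n (f : ℕ → Series) m → FiniteSums.Σ seriesRing n f m ≈ Σ n (λ i → f i m)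
  Σ-coeff zero    f m = refl
  Σ-coeff (suc n) f m = +-congʳ (Σ-coeff n f m)

  const-cong : ∀ {a b} → a ≈ b → const a ≋ const b
  const-cong e zero    = e
  const-cong e (suc n) = refl

  const-+ : ∀ a b → const (a + b) ≋ const a ⊹ const b
  const-+ a b zero    = refl
  const-+ a b (suc n) = sym (+-identityʳ _)

  const-* : ∀ a b → const (a * b) ≋ const a ⊠ const b
  const-* a b n = sym (trans (const-⊠ a (const b) n) (a*const n))
    where
    a*const : ∀ n → a * const b n ≈ const (a * b) n
    a*const zero    = refl
    a*const (suc n) = zeroʳ _

  const-0# : const 0# ≋ 𝟘
  const-0# zero    = refl
  const-0# (suc n) = refl

  constHom : RingHomomorphism rawRing (CommutativeRing.rawRing seriesRing)
  constHom = record
    { ⟦_⟧ = const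
    ; isRingHomomorphism = record
      { isSemiringHomomorphism = record
        { isNearSemiringHomomorphism = record
          { +-isMonoidHomomorphism = record
            { isMagmaHomomorphism = record
              { isRelHomomorphism = record { cong = const-cong }
              ; homo = const-+ }
            ; ε-homo = const-0# }
          ; *-homo = const-* }
        ; 1#-homo = λ n → refl }
      ; -‿homo = λ a → λ { zero → refl ; (suc n) → sym -0#≈0# } } }

  coeff₀Hom : RingHomomorphism (CommutativeRing.rawRing seriesRing) rawRing
  coeff₀Hom = record
    { ⟦_⟧ = λ F → F 0
    ; isRingHomomorphism = record
      { isSemiringHomomorphism = record
        { isNearSemiringHomomorphism = record
          { +-isMonoidHomomorphism = record
            { isMagmaHomomorphism = record
              { isRelHomomorphism = record { cong = λ e → e 0 }
              ; homo = λ _ _ → refl }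
            ; ε-homo = refl }
          ; *-homo = λ _ _ → refl }
        ; 1#-homo = refl }
      ; -‿homo = λ _ → refl } }

  ι-seriesRing : ∀ n → ιᴿ seriesRing n ≋ const (ι n)
  ι-seriesRing zero    k = sym (const-0# k)
  ι-seriesRing (suc n) k = trans (+-congˡ (ι-seriesRing n k)) (sym (const-+ 1# (ι n) k))

  X : Series
  X (suc zero) = 1#
  X _          = 0#

  shift : Series → Series
  shift F zero    = 0#
  shift F (suc n) = F n

  shift-cong : ∀ {F G} → F ≋ G → shift F ≋ shift G
  shift-cong e zero    = refl
  shift-cong e (suc n) = e n

  X-⊠ : ∀ F → X ⊠ F ≋ shift F
  X-⊠ F zero    = zeroˡ _
  X-⊠ F (suc n) = trans (Σ-split-first n _) (trans (+-cong (zeroˡ _) (tail n)) (+-identityˡ _))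
    where
    tail : ∀ n → Σ n (λ i → X (suc i) * F (n ∸ i)) ≈ F n
    tail zero    = *-identityˡ _
    tail (suc n) = trans (Σ-split-first n _)
                     (trans (+-cong (*-identityˡ _) (Σ-zero n (λ i → zeroˡ _))) (+-identityʳ _))

  ∂ : Series → Series
  ∂ F n = ι (suc n) * F (suc n)

  ∂-Leibniz : ∀ F G → ∂ (F ⊠ G) ≋ ∂ F ⊠ G ⊹ F ⊠ ∂ G
  ∂-Leibniz F G n = begin
    ι (suc n) * Σ (suc n) a
      ≈⟨ Σ-*ˡ (suc n) _ a ⟩
    Σ (suc n) (λ i → ι (suc n) * a i)
      ≈⟨ Σ-cong≤ (suc n) (λ i i≤ → trans (*-congʳ (trans (reflexive (≡.cong ι (≡.sym (ℕₚ.m+[n∸m]≡n i≤))))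
                                                        (ι-+ i (suc n ∸ i))))
                                         (distribʳ _ _ _)) ⟩
    Σ (suc n) (λ i → ι i * a i + ι (suc n ∸ i) * a i)
      ≈⟨ Σ-+ (suc n) _ _ ⟩
    Σ (suc n) (λ i → ι i * a i) + Σ (suc n) (λ i → ι (suc n ∸ i) * a i)
      ≈⟨ +-cong ∂-left ∂-right ⟩
    Σ n (λ i → (ι (suc i) * F (suc i)) * G (n ∸ i)) + Σ n (λ i → F i * (ι (suc (n ∸ i)) * G (suc (n ∸ i))))
      ∎
    where
    a : ℕ → Carrier
    a i = F i * G (suc n ∸ i)
    ∂-left : Σ (suc n) (λ i → ι i * a i) ≈ Σ n (λ i → (ι (suc i) * F (suc i)) * G (n ∸ i))
    ∂-left = begin
      Σ (suc n) (λ i → ι i * a i)                        ≈⟨ Σ-split-first n _ ⟩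
      0# * a 0 + Σ n (λ i → ι (suc i) * a (suc i))       ≈⟨ trans (+-congʳ (zeroˡ _)) (+-identityˡ _) ⟩
      Σ n (λ i → ι (suc i) * a (suc i))                  ≈⟨ Σ-cong n (λ i → sym (*-assoc _ _ _)) ⟩
      Σ n (λ i → (ι (suc i) * F (suc i)) * G (n ∸ i))    ∎
    ∂-right : Σ (suc n) (λ i → ι (suc n ∸ i) * a i) ≈ Σ n (λ i → F i * (ι (suc (n ∸ i)) * G (suc (n ∸ i))))
    ∂-right = begin
      Σ n (λ i → ι (suc n ∸ i) * a i) + ι (n ∸ n) * a (suc n)
        ≈⟨ +-congˡ (trans (*-congʳ (reflexive (≡.cong ι (ℕₚ.n∸n≡0 n)))) (zeroˡ _)) ⟩
      Σ n (λ i → ι (suc n ∸ i) * a i) + 0#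
        ≈⟨ +-identityʳ _ ⟩
      Σ n (λ i → ι (suc n ∸ i) * a i)
        ≈⟨ Σ-cong≤ n (λ i i≤ → trans (*-congʳ (reflexive (≡.cong ι (ℕₚ.+-∸-assoc 1 i≤))))
                   (trans (*-congˡ (*-congˡ (reflexive (≡.cong G (ℕₚ.+-∸-assoc 1 i≤)))))
                   (solve 3 (λ x y z → x ⊗ (y ⊗ z) ⊜ y ⊗ (x ⊗ z)) refl _ _ _))) ⟩
      Σ n (λ i → F i * (ι (suc (n ∸ i)) * G (suc (n ∸ i))))
        ∎

  ∂-derivation : Derivation seriesRing
  ∂-derivation = record { d = ∂ ; d-cong = λ e n → *-congˡ (e (suc n)) ; d-+ = λ F G n → distribˡ _ _ _ ; d-* = ∂-Leibniz }

  ∂-X : ∂ X ≋ 𝟙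
  ∂-X zero    = trans (*-identityʳ _) (+-identityʳ _)
  ∂-X (suc n) = zeroʳ _

  ∂-const : ∀ a → ∂ (const a) ≋ 𝟘
  ∂-const a n = zeroʳ _

  lift : Derivation R → Derivation seriesRing
  lift δ = record { d = λ F n → d (F n) ; d-cong = λ e n → d-cong (e n) ; d-+ = λ F G n → d-+ _ _ ; d-* = lift-Leibniz }
    where
    open Derivation δ
    d-Σ : ∀ n f → d (Σ n f) ≈ Σ n (λ i → d (f i))
    d-Σ zero    f = refl
    d-Σ (suc n) f = trans (d-+ _ _) (+-congʳ (d-Σ n f))
    lift-Leibniz : ∀ F G → (λ n → d ((F ⊠ G) n)) ≋ (λ n → d (F n)) ⊠ G ⊹ F ⊠ (λ n → d (G n))
    lift-Leibniz F G n = trans (d-Σ n _) (trans (Σ-cong n (λ i → d-* _ _)) (Σ-+ n _ _))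

  lift-const : ∀ (δ : Derivation R) a → Derivation.d (lift δ) (const a) ≋ const (Derivation.d δ a)
  lift-const δ a zero    = refl
  lift-const δ a (suc n) = Derivation.d-0# δ

  lift-X : ∀ (δ : Derivation R) → Derivation.d (lift δ) X ≋ 𝟘
  lift-X δ zero          = Derivation.d-0# δ
  lift-X δ (suc zero)    = Derivation.d-1# δ
  lift-X δ (suc (suc n)) = Derivation.d-0# δ

-- Polynomial terms without powers, so that they can be differentiated symbolically.
data Term (n : ℕ) : Set where
  con       : ℤ → Term n
  var       : Fin n → Term n
  _:+_ _:*_ : Term n → Term n → Term n
  :-_       : Term n → Term n

infixl 6 _:+_
infixl 7 _:*_

toExpr : ∀ {n} → Term n → Expr ℤ n
toExpr (con z)  = Expression.Κ z
toExpr (var i)  = Expression.Ι i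
toExpr (s :+ t) = toExpr s Expression.⊕ toExpr t
toExpr (s :* t) = toExpr s Expression.⊗ toExpr t
toExpr (:- t)   = Expression.⊝ toExpr t

∂ₜ : ∀ {n} → (Fin n → Term n) → Term n → Term n
∂ₜ ∂v (con z)  = con (+ 0)
∂ₜ ∂v (var i)  = ∂v i
∂ₜ ∂v (s :+ t) = ∂ₜ ∂v s :+ ∂ₜ ∂v t
∂ₜ ∂v (s :* t) = ∂ₜ ∂v s :* t :+ s :* ∂ₜ ∂v t
∂ₜ ∂v (:- t)   = :- ∂ₜ ∂v t

module TermSemantics {c ℓ : Level} (R : CommutativeRing c ℓ) where
  open CommutativeRing R
  open import Algebra.Properties.Ring ring using (-0#≈0#)
  open ℤSolver R using (⟦_⟧; ⟦_⟧ℤ; numeral≈ι)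

  ⟦_⟧ₜ : ∀ {n} → Term n → Vec Carrier n → Carrier
  ⟦ t ⟧ₜ ρ = ⟦ toExpr t ⟧ ρ

  module _ (δ : Derivation R) where
    open Derivation δ

    d-⟦⟧ℤ : ∀ z → d ⟦ z ⟧ℤ ≈ 0#
    d-⟦⟧ℤ (+ n)    = trans (d-cong (numeral≈ι n)) (d-ι n)
    d-⟦⟧ℤ -[1+ n ] = trans (d-neg _) (trans (-‿cong (trans (d-cong (numeral≈ι (suc n))) (d-ι (suc n)))) -0#≈0#)

    d-⟦⟧ₜ : ∀ {n} (∂v : Fin n → Term n) (ρ : Vec Carrier n) →
      (∀ i → d (lookup ρ i) ≈ ⟦ ∂v i ⟧ₜ ρ) →
      ∀ t → d (⟦ t ⟧ₜ ρ) ≈ ⟦ ∂ₜ ∂v t ⟧ₜ ρ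
    d-⟦⟧ₜ ∂v ρ h (con z)  = d-⟦⟧ℤ z
    d-⟦⟧ₜ ∂v ρ h (var i)  = h i
    d-⟦⟧ₜ ∂v ρ h (s :+ t) = trans (d-+ _ _) (+-cong (d-⟦⟧ₜ ∂v ρ h s) (d-⟦⟧ₜ ∂v ρ h t))
    d-⟦⟧ₜ ∂v ρ h (s :* t) = trans (d-* _ _) (+-cong (*-congʳ (d-⟦⟧ₜ ∂v ρ h s)) (*-congˡ (d-⟦⟧ₜ ∂v ρ h t)))
    d-⟦⟧ₜ ∂v ρ h (:- t)   = trans (d-neg _) (-‿cong (d-⟦⟧ₜ ∂v ρ h t))

module _ {c ℓ c′ ℓ′ : Level} {R : CommutativeRing c ℓ} {R′ : CommutativeRing c′ ℓ′}
         (φ : RingHomomorphism (CommutativeRing.rawRing R) (CommutativeRing.rawRing R′)) where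
  private
    module R = CommutativeRing R
    module φ = RingHomomorphism φ
    module S = ℤSolver R
    module S′ = ℤSolver R′
    module T = TermSemantics R
    module T′ = TermSemantics R′
  open CommutativeRing R′

  φ-numeral : ∀ n → φ.⟦ S.numeral n ⟧ ≈ S′.numeral n
  φ-numeral zero          = φ.0#-homo
  φ-numeral (suc zero)    = φ.1#-homo
  φ-numeral (suc (suc n)) = trans (φ.+-homo _ _) (+-cong φ.1#-homo (φ-numeral (suc n)))

  φ-⟦⟧ℤ : ∀ z → φ.⟦ S.⟦ z ⟧ℤ ⟧ ≈ S′.⟦ z ⟧ℤ
  φ-⟦⟧ℤ (+ n)    = φ-numeral n
  φ-⟦⟧ℤ -[1+ n ] = trans (φ.-‿homo _) (-‿cong (φ-numeral (suc n)))

  φ-⟦⟧ₜ : ∀ {n} (ρ : Vec R.Carrier n) t → φ.⟦ T.⟦ t ⟧ₜ ρ ⟧ ≈ T′.⟦ t ⟧ₜ (map φ.⟦_⟧ ρ)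
  φ-⟦⟧ₜ ρ (con z)  = φ-⟦⟧ℤ z
  φ-⟦⟧ₜ ρ (var i)  = sym (reflexive (lookup-map i φ.⟦_⟧ ρ))
  φ-⟦⟧ₜ ρ (s :+ t) = trans (φ.+-homo _ _) (+-cong (φ-⟦⟧ₜ ρ s) (φ-⟦⟧ₜ ρ t))
  φ-⟦⟧ₜ ρ (s :* t) = trans (φ.*-homo _ _) (*-cong (φ-⟦⟧ₜ ρ s) (φ-⟦⟧ₜ ρ t))
  φ-⟦⟧ₜ ρ (:- t)   = trans (φ.-‿homo _) (-‿cong (φ-⟦⟧ₜ ρ t))

module D2Operator {c ℓ : Level} (R : CommutativeRing c ℓ) where
  open CommutativeRing R
  open import Relation.Binary.Reasoning.Setoid setoid
  open PowerSeries R
  open ℤSolver R using (ι; solve; _⊜_)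
  open Expression using (Κ; _⊕_; _⊗_)
  private module SeriesSolver = ℤSolver seriesRing

  -- 𝓛 c₁ c₂ c₃ F = f F″ + f′ F′ + c₃ X F  with  f = c₃ X³ + c₂ X² + c₁ X
  𝓛 : Carrier → Carrier → Carrier → Series → Series
  𝓛 c₁ c₂ c₃ F =
    (C₃ ⊠ (X ⊠ (X ⊠ X)) ⊹ C₂ ⊠ (X ⊠ X) ⊹ C₁ ⊠ X) ⊠ ∂ (∂ F)
    ⊹ ((C₃ ⊹ C₃ ⊹ C₃) ⊠ (X ⊠ X) ⊹ (C₂ ⊹ C₂) ⊠ X ⊹ C₁) ⊠ ∂ F
    ⊹ C₃ ⊠ (X ⊠ F)
    where
    C₁ C₂ C₃ : Series
    C₁ = const c₁
    C₂ = const c₂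
    C₃ = const c₃

  private
    ιₑ : ∀ {m} → ℕ → Expr ℤ m
    ιₑ zero    = Κ (+ 0)
    ιₑ (suc k) = Κ (+ 1) ⊕ ιₑ k

  𝓛-coeff : ∀ c₁ c₂ c₃ F n →
    𝓛 c₁ c₂ c₃ F n ≈
      c₁ * (ι (suc n) * ι (suc n)) * F (suc n) + c₂ * (ι n * ι (suc n)) * F n + c₃ * (ι n * ι n) * shift F n
  𝓛-coeff c₁ c₂ c₃ F n = begin
    𝓛 c₁ c₂ c₃ F n
      ≈⟨ distribute n ⟩
    expanded n
      ≈⟨ +-cong (+-cong (+-cong (+-cong (+-cong (+-cong (+-cong (+-cong (+-cong
           (cX³ c₃ F″) (cX² c₂ F″)) (cX c₁ F″)) (cX² c₃ F′)) (cX² c₃ F′)) (cX² c₃ F′))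
           (cX c₂ F′)) (cX c₂ F′)) (const-⊠ c₁ F′ n)) (cX c₃ F) ⟩
    c₃ * shift (shift (shift F″)) n + c₂ * shift (shift F″) n + c₁ * shift F″ n
      + c₃ * shift (shift F′) n + c₃ * shift (shift F′) n + c₃ * shift (shift F′) n
      + c₂ * shift F′ n + c₂ * shift F′ n + c₁ * F′ n + c₃ * shift F n
      ≈⟨ collect n ⟩
    c₁ * (ι (suc n) * ι (suc n)) * F (suc n) + c₂ * (ι n * ι (suc n)) * F n + c₃ * (ι n * ι n) * shift F n
      ∎
    where
    C₁ C₂ C₃ F′ F″ expanded : Series
    C₁ = const c₁
    C₂ = const c₂
    C₃ = const c₃
    F′ = ∂ F
    F″ = ∂ (∂ F)
    expanded = C₃ ⊠ (X ⊠ (X ⊠ (X ⊠ F″))) ⊹ C₂ ⊠ (X ⊠ (X ⊠ F″)) ⊹ C₁ ⊠ (X ⊠ F″)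
               ⊹ C₃ ⊠ (X ⊠ (X ⊠ F′)) ⊹ C₃ ⊠ (X ⊠ (X ⊠ F′)) ⊹ C₃ ⊠ (X ⊠ (X ⊠ F′))
               ⊹ C₂ ⊠ (X ⊠ F′) ⊹ C₂ ⊠ (X ⊠ F′) ⊹ C₁ ⊠ F′ ⊹ C₃ ⊠ (X ⊠ F)
    distribute : 𝓛 c₁ c₂ c₃ F ≋ expanded
    distribute = SeriesSolver.solve 7 (λ a₁ a₂ a₃ x G H K →
        (a₃ ⊗ (x ⊗ (x ⊗ x)) ⊕ a₂ ⊗ (x ⊗ x) ⊕ a₁ ⊗ x) ⊗ G
        ⊕ ((a₃ ⊕ a₃ ⊕ a₃) ⊗ (x ⊗ x) ⊕ (a₂ ⊕ a₂) ⊗ x ⊕ a₁) ⊗ H ⊕ a₃ ⊗ (x ⊗ K)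
        SeriesSolver.⊜ a₃ ⊗ (x ⊗ (x ⊗ (x ⊗ G))) ⊕ a₂ ⊗ (x ⊗ (x ⊗ G)) ⊕ a₁ ⊗ (x ⊗ G)
        ⊕ a₃ ⊗ (x ⊗ (x ⊗ H)) ⊕ a₃ ⊗ (x ⊗ (x ⊗ H)) ⊕ a₃ ⊗ (x ⊗ (x ⊗ H))
        ⊕ a₂ ⊗ (x ⊗ H) ⊕ a₂ ⊗ (x ⊗ H) ⊕ a₁ ⊗ H ⊕ a₃ ⊗ (x ⊗ K))
      (λ _ → refl) C₁ C₂ C₃ X F″ F′ F
    cX : ∀ a G → (const a ⊠ (X ⊠ G)) n ≈ a * shift G n
    cX a G = trans (const-⊠ a (X ⊠ G) n) (*-congˡ (X-⊠ G n))
    cX² : ∀ a G → (const a ⊠ (X ⊠ (X ⊠ G))) n ≈ a * shift (shift G) n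
    cX² a G = trans (const-⊠ a (X ⊠ (X ⊠ G)) n) (*-congˡ (trans (X-⊠ (X ⊠ G) n) (shift-cong (X-⊠ G) n)))
    cX³ : ∀ a G → (const a ⊠ (X ⊠ (X ⊠ (X ⊠ G)))) n ≈ a * shift (shift (shift G)) n
    cX³ a G = trans (const-⊠ a (X ⊠ (X ⊠ (X ⊠ G))) n)
                (*-congˡ (trans (X-⊠ (X ⊠ (X ⊠ G)) n) (shift-cong (λ m → trans (X-⊠ (X ⊠ G) m) (shift-cong (X-⊠ G) m)) n)))
    collect : ∀ n →
      c₃ * shift (shift (shift F″)) n + c₂ * shift (shift F″) n + c₁ * shift F″ n
      + c₃ * shift (shift F′) n + c₃ * shift (shift F′) n + c₃ * shift (shift F′) n
      + c₂ * shift F′ n + c₂ * shift F′ n + c₁ * F′ n + c₃ * shift F n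
      ≈ c₁ * (ι (suc n) * ι (suc n)) * F (suc n) + c₂ * (ι n * ι (suc n)) * F n + c₃ * (ι n * ι n) * shift F n
    collect zero = solve 5 (λ a₁ a₂ a₃ f₀ f₁ →
      a₃ ⊗ Κ (+ 0) ⊕ a₂ ⊗ Κ (+ 0) ⊕ a₁ ⊗ Κ (+ 0) ⊕ a₃ ⊗ Κ (+ 0) ⊕ a₃ ⊗ Κ (+ 0) ⊕ a₃ ⊗ Κ (+ 0)
      ⊕ a₂ ⊗ Κ (+ 0) ⊕ a₂ ⊗ Κ (+ 0) ⊕ a₁ ⊗ (ιₑ 1 ⊗ f₁) ⊕ a₃ ⊗ Κ (+ 0)
      ⊜ a₁ ⊗ (ιₑ 1 ⊗ ιₑ 1) ⊗ f₁ ⊕ a₂ ⊗ (Κ (+ 0) ⊗ ιₑ 1) ⊗ f₀ ⊕ a₃ ⊗ (Κ (+ 0) ⊗ Κ (+ 0)) ⊗ Κ (+ 0))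
      refl c₁ c₂ c₃ (F 0) (F 1)
    collect (suc zero) = solve 6 (λ a₁ a₂ a₃ f₀ f₁ f₂ →
      a₃ ⊗ Κ (+ 0) ⊕ a₂ ⊗ Κ (+ 0) ⊕ a₁ ⊗ (ιₑ 1 ⊗ (ιₑ 2 ⊗ f₂)) ⊕ a₃ ⊗ Κ (+ 0) ⊕ a₃ ⊗ Κ (+ 0) ⊕ a₃ ⊗ Κ (+ 0)
      ⊕ a₂ ⊗ (ιₑ 1 ⊗ f₁) ⊕ a₂ ⊗ (ιₑ 1 ⊗ f₁) ⊕ a₁ ⊗ (ιₑ 2 ⊗ f₂) ⊕ a₃ ⊗ f₀
      ⊜ a₁ ⊗ (ιₑ 2 ⊗ ιₑ 2) ⊗ f₂ ⊕ a₂ ⊗ (ιₑ 1 ⊗ ιₑ 2) ⊗ f₁ ⊕ a₃ ⊗ (ιₑ 1 ⊗ ιₑ 1) ⊗ f₀)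
      refl c₁ c₂ c₃ (F 0) (F 1) (F 2)
    collect (suc (suc zero)) = solve 7 (λ a₁ a₂ a₃ f₀ f₁ f₂ f₃ →
      a₃ ⊗ Κ (+ 0) ⊕ a₂ ⊗ (ιₑ 1 ⊗ (ιₑ 2 ⊗ f₂)) ⊕ a₁ ⊗ (ιₑ 2 ⊗ (ιₑ 3 ⊗ f₃))
      ⊕ a₃ ⊗ (ιₑ 1 ⊗ f₁) ⊕ a₃ ⊗ (ιₑ 1 ⊗ f₁) ⊕ a₃ ⊗ (ιₑ 1 ⊗ f₁)
      ⊕ a₂ ⊗ (ιₑ 2 ⊗ f₂) ⊕ a₂ ⊗ (ιₑ 2 ⊗ f₂) ⊕ a₁ ⊗ (ιₑ 3 ⊗ f₃) ⊕ a₃ ⊗ f₁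
      ⊜ a₁ ⊗ (ιₑ 3 ⊗ ιₑ 3) ⊗ f₃ ⊕ a₂ ⊗ (ιₑ 2 ⊗ ιₑ 3) ⊗ f₂ ⊕ a₃ ⊗ (ιₑ 2 ⊗ ιₑ 2) ⊗ f₁)
      refl c₁ c₂ c₃ (F 0) (F 1) (F 2) (F 3)
    collect (suc (suc (suc k))) = solve 7 (λ a₁ a₂ a₃ t f₂ f₃ f₄ →
      let s1 = Κ (+ 1) ⊕ t ; s2 = Κ (+ 1) ⊕ s1 ; s3 = Κ (+ 1) ⊕ s2 ; s4 = Κ (+ 1) ⊕ s3 in
      a₃ ⊗ (s1 ⊗ (s2 ⊗ f₂)) ⊕ a₂ ⊗ (s2 ⊗ (s3 ⊗ f₃)) ⊕ a₁ ⊗ (s3 ⊗ (s4 ⊗ f₄))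
      ⊕ a₃ ⊗ (s2 ⊗ f₂) ⊕ a₃ ⊗ (s2 ⊗ f₂) ⊕ a₃ ⊗ (s2 ⊗ f₂)
      ⊕ a₂ ⊗ (s3 ⊗ f₃) ⊕ a₂ ⊗ (s3 ⊗ f₃) ⊕ a₁ ⊗ (s4 ⊗ f₄) ⊕ a₃ ⊗ f₂
      ⊜ a₁ ⊗ (s4 ⊗ s4) ⊗ f₄ ⊕ a₂ ⊗ (s3 ⊗ s4) ⊗ f₃ ⊕ a₃ ⊗ (s3 ⊗ s3) ⊗ f₂)
      refl c₁ c₂ c₃ (ι k) (F (2 ℕ.+ k)) (F (3 ℕ.+ k)) (F (4 ℕ.+ k))

module _ {c ℓ : Level} {R : CommutativeRing c ℓ} (δ : Derivation R) where
  open CommutativeRing R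
  open Derivation δ
  open import Relation.Binary.Reasoning.Setoid setoid
  open ℤSolver R using (numeral; solve; _⊜_)
  open Expression using (Κ; _⊕_; _⊗_)

  -- (2 P S′ + P′ S) S² P = S P · d (S² P) = 0.
  S²P≈1⇒2PS′+P′S≈0 : ∀ S P P′ → (S * S) * P ≈ 1# → d P ≈ P′ → (P * d S + P * d S) + P′ * S ≈ 0#
  S²P≈1⇒2PS′+P′S≈0 S P P′ S²P≈1 dP≈P′ = begin
    (P * d S + P * d S) + P′ * S                                ≈⟨ *-identityʳ _ ⟨
    ((P * d S + P * d S) + P′ * S) * 1#                         ≈⟨ *-congˡ S²P≈1 ⟨
    ((P * d S + P * d S) + P′ * S) * ((S * S) * P)              ≈⟨ solve 4 (λ s ds p p′ →
        ((p ⊗ ds ⊕ p ⊗ ds) ⊕ p′ ⊗ s) ⊗ ((s ⊗ s) ⊗ p)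
          ⊜ (s ⊗ p) ⊗ ((ds ⊗ s ⊕ s ⊗ ds) ⊗ p ⊕ (s ⊗ s) ⊗ p′)) refl S (d S) P P′ ⟩
    (S * P) * ((d S * S + S * d S) * P + (S * S) * P′)          ≈⟨ *-congˡ (+-cong (*-congʳ (d-* S S)) (*-congˡ dP≈P′)) ⟨
    (S * P) * (d (S * S) * P + (S * S) * d P)                   ≈⟨ *-congˡ (d-* _ _) ⟨
    (S * P) * d ((S * S) * P)                                   ≈⟨ *-congˡ (trans (d-cong S²P≈1) d-1#) ⟩
    (S * P) * 0#                                                ≈⟨ zeroʳ _ ⟩
    0#                                                          ∎

  d[2PS′+P′S]≈0 : ∀ S P P′ P″ → (P * d S + P * d S) + P′ * S ≈ 0# → d P ≈ P′ → d P′ ≈ P″ →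
    ((P′ * d S + P * d (d S)) + (P′ * d S + P * d (d S))) + (P″ * S + P′ * d S) ≈ 0#
  d[2PS′+P′S]≈0 S P P′ P″ eq dP≈P′ dP′≈P″ = begin
    ((P′ * d S + P * d (d S)) + (P′ * d S + P * d (d S))) + (P″ * S + P′ * d S)
      ≈⟨ +-cong (+-cong d[PS′] d[PS′]) (trans (d-* _ _) (+-congʳ (*-congʳ dP′≈P″))) ⟨
    (d (P * d S) + d (P * d S)) + d (P′ * S)    ≈⟨ +-congʳ (d-+ _ _) ⟨
    d (P * d S + P * d S) + d (P′ * S)          ≈⟨ d-+ _ _ ⟨
    d ((P * d S + P * d S) + P′ * S)            ≈⟨ trans (d-cong eq) d-0# ⟩
    0#                                          ∎
    where
    d[PS′] : d (P * d S) ≈ P′ * d S + P * d (d S)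
    d[PS′] = trans (d-* _ _) (+-congʳ (*-congʳ dP≈P′))

  W²≈1⇒dW≈0 : ∀ W ½ → ½ * numeral 2 ≈ 1# → W * W ≈ 1# → d W ≈ 0#
  W²≈1⇒dW≈0 W ½ ½*2≈1 W²≈1 = begin
    d W                                          ≈⟨ trans (*-congʳ ½*2≈1) (*-identityˡ _) ⟨
    (½ * numeral 2) * d W                        ≈⟨ solve 3 (λ h dw w → (h ⊗ Κ (+ 2)) ⊗ dw
                                                      ⊜ h ⊗ ((Κ (+ 1) ⊗ dw ⊕ Κ (+ 1) ⊗ dw) ⊕ Κ (+ 0) ⊗ w)) refl ½ (d W) W ⟩
    ½ * ((1# * d W + 1# * d W) + 0# * W)         ≈⟨ *-congˡ (S²P≈1⇒2PS′+P′S≈0 W 1# 0# (trans (*-identityʳ _) W²≈1) d-1#) ⟩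
    ½ * 0#                                       ≈⟨ zeroʳ ½ ⟩
    0#                                           ∎

module _ {c ℓ : Level} (R : CommutativeRing c ℓ) where
  open CommutativeRing R
  open import Relation.Binary.Reasoning.Setoid setoid

  unit-cancel : ∀ u v {x} → u * v ≈ 1# → u * x ≈ 0# → x ≈ 0#
  unit-cancel u v {x} uv≈1 ux≈0 = begin
    x              ≈⟨ *-identityˡ x ⟨
    1# * x         ≈⟨ *-congʳ (trans (*-comm _ _) uv≈1) ⟨
    (v * u) * x    ≈⟨ *-assoc _ _ _ ⟩
    v * (u * x)    ≈⟨ *-congˡ ux≈0 ⟩
    v * 0#         ≈⟨ zeroʳ v ⟩
    0#             ∎

  S²P≈1⇒fP²-invertible : ∀ S P f q → (S * S) * P ≈ 1# → q * f ≈ 1# →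
    ((f * P) * P) * (q * ((S * S) * (S * S))) ≈ 1#
  S²P≈1⇒fP²-invertible S P f q S²P≈1 qf≈1 = begin
    ((f * P) * P) * (q * ((S * S) * (S * S)))   ≈⟨ solve 4 (λ f q s p →
                                                     ((f ⊗ p) ⊗ p) ⊗ (q ⊗ ((s ⊗ s) ⊗ (s ⊗ s)))
                                                       ⊜ (q ⊗ f) ⊗ (((s ⊗ s) ⊗ p) ⊗ ((s ⊗ s) ⊗ p)))
                                                   refl f q S P ⟩
    (q * f) * (((S * S) * P) * ((S * S) * P))   ≈⟨ *-cong qf≈1 (*-cong S²P≈1 S²P≈1) ⟩
    1# * (1# * 1#)                              ≈⟨ trans (*-identityˡ _) (*-identityʳ _) ⟩
    1#                                          ∎
    where
    open ℤSolver R using (solve; _⊜_)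
    open Expression using (_⊗_)

module FieldProperties {c ℓ : Level} (K : CharZeroField c ℓ) where
  open CharZeroField K
  open import Relation.Binary.Reasoning.Setoid setoid

  1#≉0# : ¬ (1# ≈ 0#)
  1#≉0# 1≈0 = char0 0 (trans (+-identityʳ 1#) 1≈0)

  x*y≈1⇒x≉0 : ∀ {x y} → x * y ≈ 1# → ¬ (x ≈ 0#)
  x*y≈1⇒x≉0 {x} {y} xy≈1 x≈0 = 1#≉0# (trans (sym xy≈1) (trans (*-congʳ x≈0) (zeroˡ y)))

  *-cancelˡ-≉0 : ∀ {a} → ¬ (a ≈ 0#) → ∀ {x y} → a * x ≈ a * y → x ≈ y
  *-cancelˡ-≉0 {a} a≉0 {x} {y} ax≈ay = begin
    x               ≈⟨ *-identityˡ x ⟨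
    1# * x          ≈⟨ *-congʳ a⁻¹a≈1 ⟨
    (a⁻¹ * a) * x   ≈⟨ *-assoc _ _ _ ⟩
    a⁻¹ * (a * x)   ≈⟨ *-congˡ ax≈ay ⟩
    a⁻¹ * (a * y)   ≈⟨ *-assoc _ _ _ ⟨
    (a⁻¹ * a) * y   ≈⟨ *-congʳ a⁻¹a≈1 ⟩
    1# * y          ≈⟨ *-identityˡ y ⟩
    y               ∎
    where
    a⁻¹ : Carrier
    a⁻¹ = inv a a≉0
    a⁻¹a≈1 : a⁻¹ * a ≈ 1#
    a⁻¹a≈1 = trans (*-comm _ _) (inv-r a a≉0)

  *-≉0 : ∀ {a b} → ¬ (a ≈ 0#) → ¬ (b ≈ 0#) → ¬ (a * b ≈ 0#)
  *-≉0 {a} {b} a≉0 b≉0 ab≈0 = b≉0 (*-cancelˡ-≉0 a≉0 (trans ab≈0 (sym (zeroʳ a))))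

  *-zeroˡ-≉0 : ∀ {a} → ¬ (a ≈ 0#) → ∀ {x} → a * x ≈ 0# → x ≈ 0#
  *-zeroˡ-≉0 a≉0 ax≈0 = *-cancelˡ-≉0 a≉0 (trans ax≈0 (sym (zeroʳ _)))

module KroneckerDelta {c ℓ : Level} (R : CommutativeRing c ℓ) where
  open CommutativeRing R

  δ : ℕ → ℕ → Carrier
  δ zero    zero    = 1#
  δ zero    (suc m) = 0#
  δ (suc l) zero    = 0#
  δ (suc l) (suc m) = δ l m

  δ-diag : ∀ n → δ n n ≈ 1#
  δ-diag zero    = refl
  δ-diag (suc n) = δ-diag n

  δ-off : ∀ n m → ¬ (m ≡ n) → δ n m ≈ 0#
  δ-off zero    zero    m≢n = contradiction ≡.refl m≢n
  δ-off zero    (suc m) m≢n = refl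
  δ-off (suc n) zero    m≢n = refl
  δ-off (suc n) (suc m) m≢n = δ-off n m (λ m≡n → m≢n (≡.cong suc m≡n))

module BasisPolynomials {ℓ₁ ℓ₂ : Level} (K : CharZeroField ℓ₁ ℓ₂) (A B : CharZeroField.Carrier K)
                        (hB : ¬ (CharZeroField._≈_ K B (CharZeroField.0# K))) where
  open CharZeroField K hiding (zero)
  open Setup K A B hB using (Poly; _≈ᴾ_; b; step; zeroᴾ; shiftᴾ; _·ᴾ_; Σ≤; HasDegree)
  open FieldProperties K
  open KroneckerDelta commRing
  module Pz = PowerSeries commRing
  open Pz using (Σ; Σ-cong; Σ-cong≤; Σ-zero; Σ-+; Σ-*ˡ; Σ-split-first; Σ-neg)
  open ℤSolver commRing using (solve; _⊜_; ι-*)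
  open Expression using (Κ; _⊕_; _⊗_; ⊝_)
  open import Relation.Binary.Reasoning.Setoid setoid
  open import Algebra.Properties.Ring ring using (-0#≈0#; x∙y⁻¹≈ε⇒x≈y; x≈y⇒x∙y⁻¹≈ε; [y-z]x≈yx-zx)

  Σ≤≈Σ : ∀ n f → Σ≤ n f ≈ Σ n f
  Σ≤≈Σ zero    f = refl
  Σ≤≈Σ (suc n) f = +-congʳ (Σ≤≈Σ n f)

  b-prev : ℕ → Poly
  b-prev zero    = zeroᴾ
  b-prev (suc n) = b n

  b-suc : ∀ n j → b (suc n) j ≡ step n (b n) (b-prev n) j
  b-suc zero    j = ≡.refl
  b-suc (suc n) j = ≡.refl

  lead lead⁻¹ : ℕ → Carrier
  lead n   = B * ι (suc n ℕ.* suc n)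
  lead⁻¹ n = inv B hB * inv (ι (suc n ℕ.* suc n)) (char0 (n ℕ.+ n ℕ.* suc n))

  lead*lead⁻¹≈1 : ∀ n → lead n * lead⁻¹ n ≈ 1#
  lead*lead⁻¹≈1 n = begin
    (B * ι N) * (inv B hB * inv (ι N) N≉0)    ≈⟨ solve 4 (λ a b c d → (a ⊗ b) ⊗ (c ⊗ d) ⊜ (a ⊗ c) ⊗ (b ⊗ d))
                                                   refl B (ι N) (inv B hB) (inv (ι N) N≉0) ⟩
    (B * inv B hB) * (ι N * inv (ι N) N≉0)    ≈⟨ *-cong (inv-r B hB) (inv-r (ι N) N≉0) ⟩
    1# * 1#                                   ≈⟨ *-identityʳ 1# ⟩
    1#                                        ∎
    where
    N : ℕ
    N = suc n ℕ.* suc n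
    N≉0 : ¬ (ι N ≈ 0#)
    N≉0 = char0 (n ℕ.+ n ℕ.* suc n)

  lead⁻¹≉0 : ∀ n → ¬ (lead⁻¹ n ≈ 0#)
  lead⁻¹≉0 n = x*y≈1⇒x≉0 (trans (*-comm _ _) (lead*lead⁻¹≈1 n))

  λ*b : ∀ n j → shiftᴾ (b n) j ≈ lead n * b (suc n) j + A * ι (n ℕ.* suc n) * b n j + ι (n ℕ.* n) * b-prev n j
  λ*b n j = begin
    s                                          ≈⟨ solve 3 (λ s a p → s ⊜ Κ (+ 1) ⊗ ((s ⊕ ⊝ a) ⊕ ⊝ p) ⊕ a ⊕ p) refl s a p ⟩
    1# * r + a + p                             ≈⟨ +-congʳ (+-congʳ (*-congʳ (lead*lead⁻¹≈1 n))) ⟨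
    (lead n * lead⁻¹ n) * r + a + p            ≈⟨ +-congʳ (+-congʳ (*-assoc _ _ _)) ⟩
    lead n * (lead⁻¹ n * r) + a + p            ≡⟨ ≡.cong (λ t → lead n * t + a + p) (≡.sym (b-suc n j)) ⟩
    lead n * b (suc n) j + a + p               ∎
    where
    s a p r : Carrier
    s = shiftᴾ (b n) j
    a = A * ι (n ℕ.* suc n) * b n j
    p = ι (n ℕ.* n) * b-prev n j
    r = (s + - a) + - p

  private
    step-zero : ∀ u s p q r t → s ≈ 0# → p ≈ 0# → r ≈ 0# → u * ((s + - (q * p)) + - (t * r)) ≈ 0#
    step-zero u s p q r t s≈0 p≈0 r≈0 = begin
      u * ((s + - (q * p)) + - (t * r))   ≈⟨ *-congˡ (+-cong (+-cong s≈0 (-‿cong (*0 q p≈0))) (-‿cong (*0 t r≈0))) ⟩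
      u * ((0# + - 0#) + - 0#)            ≈⟨ *-congˡ (trans (+-cong (trans (+-identityˡ _) -0#≈0#) -0#≈0#) (+-identityˡ 0#)) ⟩
      u * 0#                              ≈⟨ zeroʳ u ⟩
      0#                                  ∎
      where
      *0 : ∀ a {x} → x ≈ 0# → a * x ≈ 0#
      *0 a x≈0 = trans (*-congˡ x≈0) (zeroʳ a)

  mutual
    b-vanishes : ∀ n j → n < j → b n j ≈ 0#
    b-vanishes zero    (suc j) _         = refl
    b-vanishes (suc n) (suc j) (s≤s n<j) = trans (reflexive (b-suc n (suc j)))
      (step-zero _ _ _ _ _ _ (b-vanishes n j n<j) (b-vanishes n (suc j) (ℕₚ.m<n⇒m<1+n n<j))
                             (b-prev-vanishes n (suc j) (ℕₚ.<⇒≤ (ℕₚ.m<n⇒m<1+n n<j))))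

    b-prev-vanishes : ∀ n j → n ≤ j → b-prev n j ≈ 0#
    b-prev-vanishes zero    j _   = refl
    b-prev-vanishes (suc n) j n≤j = b-vanishes n j n≤j

  b-top : ∀ n → b (suc n) (suc n) ≈ lead⁻¹ n * b n n
  b-top n = trans (reflexive (b-suc n (suc n))) (*-congˡ (begin
    (b n n + - (A * ι (n ℕ.* suc n) * b n (suc n))) + - (ι (n ℕ.* n) * b-prev n (suc n))
      ≈⟨ +-cong (+-congˡ (-‿cong (*0 (b-vanishes n (suc n) (ℕₚ.n<1+n n)))))
                (-‿cong (*0 (b-prev-vanishes n (suc n) (ℕₚ.n≤1+n n)))) ⟩
    (b n n + - 0#) + - 0#
      ≈⟨ trans (+-cong (trans (+-congˡ -0#≈0#) (+-identityʳ _)) -0#≈0#) (+-identityʳ _) ⟩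
    b n n
      ∎))
    where
    *0 : ∀ {a x} → x ≈ 0# → a * x ≈ 0#
    *0 {a} x≈0 = trans (*-congˡ x≈0) (zeroʳ a)

  b-top≉0 : ∀ n → ¬ (b n n ≈ 0#)
  b-top≉0 zero    = 1#≉0#
  b-top≉0 (suc n) top≈0 = *-≉0 (lead⁻¹≉0 n) (b-top≉0 n) (trans (sym (b-top n)) top≈0)

  b-degree : ∀ n → HasDegree (b n) n
  b-degree n = b-top≉0 n , b-vanishes n

  product-degree : ∀ k l j → k ℕ.+ l < j → (b k ·ᴾ b l) j ≈ 0#
  product-degree k l j k+l<j = trans (Σ≤≈Σ j _) (trans (Σ-cong≤ j term≈0) (Σ-zero j (λ _ → refl)))
    where
    term≈0 : ∀ i → i ≤ j → b k i * b l (j ∸ i) ≈ 0#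
    term≈0 i i≤j with k ℕₚ.<? i
    ... | yes k<i = trans (*-congʳ (b-vanishes k i k<i)) (zeroˡ _)
    ... | no  k≮i = trans (*-congˡ (b-vanishes l (j ∸ i) (ℕₚ.m+n≤o⇒m≤o∸n (suc l) l+i<j))) (zeroʳ _)
      where
      l+i<j : suc l ℕ.+ i ≤ j
      l+i<j = ℕₚ.≤-trans (s≤s (ℕₚ.≤-trans (ℕₚ.+-monoʳ-≤ l (ℕₚ.≮⇒≥ k≮i)) (ℕₚ.≤-reflexive (ℕₚ.+-comm l k)))) k+l<j

  combination : ℕ → (ℕ → Carrier) → Poly
  combination N c j = Σ N (λ m → c m * b m j)

  combination≈0⇒top≈0 : ∀ N d → combination (suc N) d ≈ᴾ zeroᴾ → d (suc N) ≈ 0#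
  combination≈0⇒top≈0 N d comb≈0 = *-zeroˡ-≉0 (b-top≉0 (suc N)) (begin
    b (suc N) (suc N) * d (suc N)            ≈⟨ *-comm _ _ ⟩
    d (suc N) * b (suc N) (suc N)            ≈⟨ +-identityˡ _ ⟨
    0# + d (suc N) * b (suc N) (suc N)       ≈⟨ +-congʳ below≈0 ⟨
    combination (suc N) d (suc N)            ≈⟨ comb≈0 (suc N) ⟩
    0#                                       ∎)
    where
    below≈0 : Σ N (λ m → d m * b m (suc N)) ≈ 0#
    below≈0 = trans (Σ-cong≤ N (λ m m≤N → trans (*-congˡ (b-vanishes m (suc N) (s≤s m≤N))) (zeroʳ _)))
                    (Σ-zero N (λ _ → refl))

  combination≈0⇒≈0 : ∀ N d → combination N d ≈ᴾ zeroᴾ → ∀ m → m ≤ N → d m ≈ 0#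
  combination≈0⇒≈0 zero    d comb≈0 zero _ = trans (sym (*-identityʳ _)) (comb≈0 0)
  combination≈0⇒≈0 (suc N) d comb≈0 m  m≤N with ℕₚ.m≤n⇒m<n∨m≡n m≤N
  ... | inj₁ (s≤s m≤N′) = combination≈0⇒≈0 N d lower≈0 m m≤N′
    where
    lower≈0 : combination N d ≈ᴾ zeroᴾ
    lower≈0 j = trans (sym (+-identityʳ _))
                  (trans (+-congˡ (sym (trans (*-congʳ (combination≈0⇒top≈0 N d comb≈0)) (zeroˡ _)))) (comb≈0 j))
  ... | inj₂ ≡.refl = combination≈0⇒top≈0 N d comb≈0

  combination-injective : ∀ N c c′ → combination N c ≈ᴾ combination N c′ → ∀ m → m ≤ N → c m ≈ c′ m
  combination-injective N c c′ c≈c′ m m≤N = x∙y⁻¹≈ε⇒x≈y _ _ (combination≈0⇒≈0 N (λ m → c m - c′ m) difference≈0 m m≤N)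
    where
    difference≈0 : combination N (λ m → c m - c′ m) ≈ᴾ zeroᴾ
    difference≈0 j = begin
      Σ N (λ m → (c m - c′ m) * b m j)                 ≈⟨ Σ-cong N (λ m → [y-z]x≈yx-zx _ _ _) ⟩
      Σ N (λ m → c m * b m j - c′ m * b m j)           ≈⟨ Σ-+ N _ _ ⟩
      combination N c j + Σ N (λ m → - (c′ m * b m j)) ≈⟨ +-congˡ (Σ-neg N _) ⟨
      combination N c j - combination N c′ j           ≈⟨ x≈y⇒x∙y⁻¹≈ε (c≈c′ j) ⟩
      0#                                               ∎

  top-coefficient : ℕ → Poly → Carrier
  top-coefficient N p = p (suc N) * inv (b (suc N) (suc N)) (b-top≉0 (suc N))

  lower-part : ℕ → Poly → Poly
  lower-part N p j = p j - top-coefficient N p * b (suc N) j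

  coordinates : ℕ → Poly → ℕ → Carrier
  coordinates zero    p m = p 0 * δ 0 m
  coordinates (suc N) p m = coordinates N (lower-part N p) m + δ (suc N) m * top-coefficient N p

  coordinates-vanish : ∀ N p m → N < m → coordinates N p m ≈ 0#
  coordinates-vanish zero    p (suc m) _    = zeroʳ _
  coordinates-vanish (suc N) p m       N<m  =
    trans (+-cong (coordinates-vanish N (lower-part N p) m (ℕₚ.<-trans (ℕₚ.n<1+n N) N<m))
                  (trans (*-congʳ (δ-off (suc N) m (λ m≡ → ℕₚ.<-irrefl (≡.sym m≡) N<m))) (zeroˡ _)))
          (+-identityˡ 0#)

  top-coefficient-cancels : ∀ N p → top-coefficient N p * b (suc N) (suc N) ≈ p (suc N)
  top-coefficient-cancels N p = begin
    (p (suc N) * t⁻¹) * t   ≈⟨ *-assoc _ _ _ ⟩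
    p (suc N) * (t⁻¹ * t)   ≈⟨ *-congˡ (trans (*-comm t⁻¹ t) (inv-r t (b-top≉0 (suc N)))) ⟩
    p (suc N) * 1#          ≈⟨ *-identityʳ _ ⟩
    p (suc N)               ∎
    where
    t t⁻¹ : Carrier
    t   = b (suc N) (suc N)
    t⁻¹ = inv t (b-top≉0 (suc N))

  lower-part-degree : ∀ N p → (∀ j → suc N < j → p j ≈ 0#) → ∀ j → N < j → lower-part N p j ≈ 0#
  lower-part-degree N p p-deg j N<j = [ above , at ]′ (ℕₚ.m≤n⇒m<n∨m≡n N<j)
    where
    above : suc N < j → lower-part N p j ≈ 0#
    above N+1<j = trans (+-cong (p-deg j N+1<j) (-‿cong (trans (*-congˡ (b-vanishes (suc N) j N+1<j)) (zeroʳ _))))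
                        (trans (+-identityˡ _) -0#≈0#)
    at : suc N ≡ j → lower-part N p j ≈ 0#
    at ≡.refl = x≈y⇒x∙y⁻¹≈ε (sym (top-coefficient-cancels N p))

  expansion : ∀ N p → (∀ j → N < j → p j ≈ 0#) → p ≈ᴾ combination N (coordinates N p)
  expansion zero    p p-deg zero    = sym (trans (*-identityʳ _) (*-identityʳ _))
  expansion zero    p p-deg (suc j) = trans (p-deg (suc j) (s≤s z≤n)) (sym (zeroʳ _))
  expansion (suc N) p p-deg j = begin
    p j                                           ≈⟨ solve 2 (λ x y → x ⊜ (x ⊕ ⊝ y) ⊕ y) refl (p j) (α * b (suc N) j) ⟩
    lower-part N p j + α * b (suc N) j            ≈⟨ +-cong (expansion N _ (lower-part-degree N p p-deg) j) (*-congʳ (sym top)) ⟩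
    combination N c′ j + c (suc N) * b (suc N) j  ≈⟨ +-congʳ lower ⟩
    combination (suc N) c j                       ∎
    where
    α : Carrier
    α = top-coefficient N p
    c′ c : ℕ → Carrier
    c′ = coordinates N (lower-part N p)
    c  = coordinates (suc N) p
    top : c (suc N) ≈ α
    top = trans (+-cong (coordinates-vanish N _ (suc N) (ℕₚ.n<1+n N)) (trans (*-congʳ (δ-diag (suc N))) (*-identityˡ _)))
                (+-identityˡ _)
    lower : combination N c′ j ≈ Σ N (λ m → c m * b m j)
    lower = Σ-cong≤ N (λ m m≤N → *-congʳ (sym (trans (+-congˡ (trans (*-congʳ
              (δ-off (suc N) m (λ m≡ → ℕₚ.<-irrefl m≡ (s≤s m≤N)))) (zeroˡ _))) (+-identityʳ _))))

  combination-extend : ∀ N (c : ℕ → Carrier) → c (suc N) ≈ 0# → combination (suc N) c ≈ᴾ combination N c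
  combination-extend N c c≈0 j = trans (+-congˡ (trans (*-congʳ c≈0) (zeroˡ _))) (+-identityʳ _)

  combination-cong : ∀ N {c c′} → (∀ m → m ≤ N → c m ≈ c′ m) → combination N c ≈ᴾ combination N c′
  combination-cong N c≈c′ j = Σ-cong≤ N (λ m m≤N → *-congʳ (c≈c′ m m≤N))

  const⊠combination : ∀ N a (c : ℕ → Carrier) → (Pz.const a Pz.⊠ combination N c) ≈ᴾ combination N (λ m → a * c m)
  const⊠combination N a c j = trans (Pz.const-⊠ a (combination N c) j)
                                (trans (Σ-*ˡ N a _) (Σ-cong N (λ m → sym (*-assoc _ _ _))))

  combination-+ : ∀ N (c c′ : ℕ → Carrier) → (combination N c Pz.⊹ combination N c′) ≈ᴾ combination N (λ m → c m + c′ m)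
  combination-+ N c c′ j = trans (sym (Σ-+ N _ _)) (Σ-cong N (λ m → sym (distribʳ _ _ _)))

  X⊠b : ∀ k → (Pz.X Pz.⊠ b k) ≈ᴾ
    (Pz.const (lead k) Pz.⊠ b (suc k) Pz.⊹ Pz.const (A * ι (k ℕ.* suc k)) Pz.⊠ b k
     Pz.⊹ Pz.const (ι (k ℕ.* k)) Pz.⊠ b-prev k)
  X⊠b k j = begin
    (Pz.X Pz.⊠ b k) j                ≈⟨ Pz.X-⊠ (b k) j ⟩
    Pz.shift (b k) j                 ≈⟨ shift≈shiftᴾ j ⟩
    shiftᴾ (b k) j                   ≈⟨ λ*b k j ⟩
    lead k * b (suc k) j + A * ι (k ℕ.* suc k) * b k j + ι (k ℕ.* k) * b-prev k j
      ≈⟨ +-cong (+-cong (Pz.const-⊠ _ (b (suc k)) j) (Pz.const-⊠ _ (b k) j)) (Pz.const-⊠ _ (b-prev k) j) ⟨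
    (Pz.const (lead k) Pz.⊠ b (suc k) Pz.⊹ Pz.const (A * ι (k ℕ.* suc k)) Pz.⊠ b k
     Pz.⊹ Pz.const (ι (k ℕ.* k)) Pz.⊠ b-prev k) j ∎
    where
    shift≈shiftᴾ : ∀ j → Pz.shift (b k) j ≈ shiftᴾ (b k) j
    shift≈shiftᴾ zero    = refl
    shift≈shiftᴾ (suc j) = refl

  -- the coordinates of λ · Σₘ cₘ bₘ
  λ-coordinates : (ℕ → Carrier) → ℕ → Carrier
  λ-coordinates c m = 1# * (ι (suc m) * ι (suc m)) * c (suc m) + A * (ι m * ι (suc m)) * c m
                      + B * (ι m * ι m) * Pz.shift c m

  Σ-b-suc : ∀ N (f : ℕ → Carrier) j → Σ N (λ m → f m * b (suc m) j) ≈ combination (suc N) (Pz.shift f) j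
  Σ-b-suc N f j = sym (trans (Σ-split-first N (λ m → Pz.shift f m * b m j)) (trans (+-congʳ (zeroˡ _)) (+-identityˡ _)))

  Σ-b-prev : ∀ N (g : ℕ → Carrier) j → g (suc N) ≈ 0# → g (suc (suc N)) ≈ 0# →
    Σ N (λ m → g m * b-prev m j) ≈ combination (suc N) (λ m → g (suc m)) j
  Σ-b-prev zero    g j g₁≈0 g₂≈0 = trans (zeroʳ _) (sym (trans (+-cong (*0 g₁≈0) (*0 g₂≈0)) (+-identityˡ 0#)))
    where
    *0 : ∀ {a x} → a ≈ 0# → a * x ≈ 0#
    *0 {x = x} a≈0 = trans (*-congʳ a≈0) (zeroˡ x)
  Σ-b-prev (suc N) g j gN≈0 gN′≈0 = begin
    Σ (suc N) (λ m → g m * b-prev m j)                          ≈⟨ Σ-split-first N (λ m → g m * b-prev m j) ⟩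
    g 0 * 0# + Σ N (λ m → g (suc m) * b m j)                     ≈⟨ trans (+-congʳ (zeroʳ _)) (+-identityˡ _) ⟩
    combination N (λ m → g (suc m)) j                            ≈⟨ combination-extend N (λ m → g (suc m)) gN≈0 j ⟨
    combination (suc N) (λ m → g (suc m)) j                      ≈⟨ combination-extend (suc N) (λ m → g (suc m)) gN′≈0 j ⟨
    combination (suc (suc N)) (λ m → g (suc m)) j                ∎

  X⊠combination : ∀ N (c : ℕ → Carrier) → (∀ m → N < m → c m ≈ 0#) →
    (Pz.X Pz.⊠ combination N c) ≈ᴾ combination (suc N) (λ-coordinates c)
  X⊠combination N c c-deg j = begin
    (Pz.X Pz.⊠ combination N c) j
      ≈⟨ trans (Pz.X-⊠ (combination N c) j) (shift-combination j) ⟩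
    Σ N (λ m → c m * shiftᴾ (b m) j)
      ≈⟨ Σ-cong N (λ m → trans (*-congˡ (λ*b m j)) (distribute (c m) _ _ _ _ _ _)) ⟩
    Σ N (λ m → ((c m * lead m) * b (suc m) j + (A * ι (m ℕ.* suc m) * c m) * b m j)
               + (ι (m ℕ.* m) * c m) * b-prev m j)
      ≈⟨ trans (Σ-+ N (λ m → (c m * lead m) * b (suc m) j + (A * ι (m ℕ.* suc m) * c m) * b m j)
                      (λ m → (ι (m ℕ.* m) * c m) * b-prev m j))
               (+-congʳ (Σ-+ N (λ m → (c m * lead m) * b (suc m) j) (λ m → (A * ι (m ℕ.* suc m) * c m) * b m j))) ⟩
    (Σ N (λ m → (c m * lead m) * b (suc m) j) + Σ N (λ m → (A * ι (m ℕ.* suc m) * c m) * b m j))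
      + Σ N (λ m → (ι (m ℕ.* m) * c m) * b-prev m j)
      ≈⟨ +-cong (+-cong sum₁ sum₂) sum₃ ⟩
    (combination (suc N) e₁ j + combination (suc N) e₂ j) + combination (suc N) e₃ j
      ≈⟨ trans (+-congʳ (combination-+ (suc N) e₁ e₂ j)) (combination-+ (suc N) (λ m → e₁ m + e₂ m) e₃ j) ⟩
    combination (suc N) (λ m → (e₁ m + e₂ m) + e₃ m) j
      ≈⟨ combination-cong (suc N) (λ m _ → solve 3 (λ x y z → (x ⊕ y) ⊕ z ⊜ z ⊕ y ⊕ x) refl (e₁ m) (e₂ m) (e₃ m)) j ⟩
    combination (suc N) (λ-coordinates c) j
      ∎
    where
    e₁ e₂ e₃ : ℕ → Carrier
    e₁ m = B * (ι m * ι m) * Pz.shift c m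
    e₂ m = A * (ι m * ι (suc m)) * c m
    e₃ m = 1# * (ι (suc m) * ι (suc m)) * c (suc m)
    *0 : ∀ {a x} → x ≈ 0# → a * x ≈ 0#
    *0 {a} x≈0 = trans (*-congˡ x≈0) (zeroʳ a)
    sum₁ : Σ N (λ m → (c m * lead m) * b (suc m) j) ≈ combination (suc N) e₁ j
    sum₁ = trans (Σ-b-suc N (λ m → c m * lead m) j) (combination-cong (suc N) up j)
      where
      up : ∀ m → m ≤ suc N → Pz.shift (λ m → c m * lead m) m ≈ e₁ m
      up zero    _ = sym (zeroʳ _)
      up (suc m) _ = trans (*-comm _ _) (*-congʳ (*-congˡ (ι-* (suc m) (suc m))))
    sum₂ : Σ N (λ m → (A * ι (m ℕ.* suc m) * c m) * b m j) ≈ combination (suc N) e₂ j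
    sum₂ = trans (Σ-cong N (λ m → *-congʳ (*-congʳ (*-congˡ (ι-* m (suc m))))))
                 (sym (combination-extend N e₂ (*0 (c-deg (suc N) (ℕₚ.n<1+n N))) j))
    sum₃ : Σ N (λ m → (ι (m ℕ.* m) * c m) * b-prev m j) ≈ combination (suc N) e₃ j
    sum₃ = trans (Σ-b-prev N (λ m → ι (m ℕ.* m) * c m) j (*0 (c-deg (suc N) (ℕₚ.n<1+n N)))
                                                      (*0 (c-deg (suc (suc N)) (ℕₚ.m<n⇒m<1+n (ℕₚ.n<1+n N)))))
                 (combination-cong (suc N) (λ m _ → *-congʳ (trans (ι-* (suc m) (suc m)) (sym (*-identityˡ _)))) j)
    shift-combination : ∀ j → Pz.shift (combination N c) j ≈ Σ N (λ m → c m * shiftᴾ (b m) j)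
    shift-combination zero    = sym (Σ-zero N (λ m → zeroʳ _))
    shift-combination (suc j) = refl
    distribute : ∀ c x y z p q r → c * (x * y + p * z + q * r) ≈ ((c * x) * y + (p * c) * z) + (q * c) * r
    distribute = solve 7 (λ c x y z p q r → c ⊗ (x ⊗ y ⊕ p ⊗ z ⊕ q ⊗ r) ⊜ ((c ⊗ x) ⊗ y ⊕ (p ⊗ c) ⊗ z) ⊕ (q ⊗ c) ⊗ r) refl

module TrivariateSeries {c ℓ : Level} (K : CharZeroField c ℓ) (A B : CharZeroField.Carrier K)
                        (hB : ¬ (CharZeroField._≈_ K B (CharZeroField.0# K))) where
  open CharZeroField K hiding (zero)
  open Setup K A B hB
  open BasisPolynomials K A B hB using (Σ≤≈Σ)
  open import Relation.Binary.Reasoning.Setoid setoid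

  -- Ser is read as R[[z]][[y]][[x]]: F k is the coefficient of xᵏ, F k l that of xᵏ yˡ.
  R : CommutativeRing c ℓ
  R = commRing
  module Pz = PowerSeries R
  Rz : CommutativeRing c ℓ
  Rz = Pz.seriesRing
  module Pyz = PowerSeries Rz
  Ryz : CommutativeRing c ℓ
  Ryz = Pyz.seriesRing
  module Pxyz = PowerSeries Ryz
  Rxyz : CommutativeRing c ℓ
  Rxyz = Pxyz.seriesRing
  module Rz = CommutativeRing Rz
  module Ryz = CommutativeRing Ryz
  module Rxyz = CommutativeRing Rxyz

  constyz : RingHomomorphism rawRing Ryz.rawRing
  constyz = ringHomomorphism {M₁ = ring} {M₂ = Rz.ring} {M₃ = Ryz.ring} Pz.constHom Pyz.constHom

  constxyz : RingHomomorphism Rz.rawRing Rxyz.rawRing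
  constxyz = ringHomomorphism {M₁ = Rz.ring} {M₂ = Ryz.ring} {M₃ = Rxyz.ring} Pyz.constHom Pxyz.constHom

  κ-hom : RingHomomorphism rawRing Rxyz.rawRing
  κ-hom = ringHomomorphism {M₁ = ring} {M₂ = Ryz.ring} {M₃ = Rxyz.ring} constyz Pxyz.constHom

  module constyz = RingHomomorphism constyz
  module constxyz = RingHomomorphism constxyz
  module κ-hom = RingHomomorphism κ-hom

  κ : Carrier → Ser
  κ = κ-hom.⟦_⟧

  X₃ Y₃ Z₃ : Ser
  X₃ = Pxyz.X
  Y₃ = Pxyz.const Pyz.X
  Z₃ = Pxyz.const (Pyz.const Pz.X)

  ⊛≈⊠ : ∀ F G → (F ⊛ G) ≈ˢ (F Pxyz.⊠ G)
  ⊛≈⊠ F G k l m = sym (begin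
    (F Pxyz.⊠ G) k l m
      ≈⟨ Pyz.Σ-coeff k _ l m ⟩
    Pyz.Σ k (λ a → (F a Pyz.⊠ G (k ∸ a)) l) m
      ≈⟨ Pz.Σ-coeff k _ m ⟩
    Pz.Σ k (λ a → (F a Pyz.⊠ G (k ∸ a)) l m)
      ≈⟨ Pz.Σ-cong k (λ a → Pz.Σ-coeff l _ m) ⟩
    Pz.Σ k (λ a → Pz.Σ l (λ b′ → (F a b′ Pz.⊠ G (k ∸ a) (l ∸ b′)) m))
      ≈⟨ trans (Pz.Σ-cong k (λ a → Pz.Σ-cong l (λ b′ → sym (Σ≤≈Σ m _)))) (Pz.Σ-cong k (λ a → sym (Σ≤≈Σ l _))) ⟩
    Pz.Σ k (λ a → Σ≤ l (λ b′ → Σ≤ m (λ c′ → F a b′ c′ * G (k ∸ a) (l ∸ b′) (m ∸ c′))))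
      ≈⟨ Σ≤≈Σ k _ ⟨
    (F ⊛ G) k l m
      ∎)

  κ-⊠ : ∀ a F k l m → (κ a Pxyz.⊠ F) k l m ≈ a * F k l m
  κ-⊠ a F k l m = trans (Pxyz.const-⊠ _ F k l m) (trans (Pyz.const-⊠ _ (F k) l m) (Pz.const-⊠ a (F k l) m))

  constyz-⊠ : ∀ a (G : Ryz.Carrier) l m → (constyz.⟦ a ⟧ Pyz.⊠ G) l m ≈ a * G l m
  constyz-⊠ a G l m = trans (Pyz.const-⊠ _ G l m) (Pz.const-⊠ a (G l) m)

  constxyz-⊠ : ∀ (h : Rz.Carrier) F k l → (constxyz.⟦ h ⟧ Pxyz.⊠ F) k l Rz.≈ (h Pz.⊠ F k l)
  constxyz-⊠ h F k l m = trans (Pxyz.const-⊠ _ F k l m) (Pyz.const-⊠ h (F k) l m)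

  •≈κ⊠ : ∀ a F → (a • F) ≈ˢ (κ a Pxyz.⊠ F)
  •≈κ⊠ a F k l m = sym (κ-⊠ a F k l m)

  cst≈κ : ∀ a → cst a ≈ˢ κ a
  cst≈κ a zero    zero    zero    = refl
  cst≈κ a zero    zero    (suc m) = refl
  cst≈κ a zero    (suc l) m       = refl
  cst≈κ a (suc k) l       m       = refl

  X≈X₃ : X ≈ˢ X₃
  X≈X₃ zero          l       m       = refl
  X≈X₃ (suc zero)    zero    zero    = refl
  X≈X₃ (suc zero)    zero    (suc m) = refl
  X≈X₃ (suc zero)    (suc l) m       = refl
  X≈X₃ (suc (suc k)) l       m       = refl

  Y≈Y₃ : Y ≈ˢ Y₃
  Y≈Y₃ zero    zero          m       = refl
  Y≈Y₃ zero    (suc zero)    zero    = refl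
  Y≈Y₃ zero    (suc zero)    (suc m) = refl
  Y≈Y₃ zero    (suc (suc l)) m       = refl
  Y≈Y₃ (suc k) l             m       = refl

  Z≈Z₃ : Z ≈ˢ Z₃
  Z≈Z₃ zero    zero    zero          = refl
  Z≈Z₃ zero    zero    (suc zero)    = refl
  Z≈Z₃ zero    zero    (suc (suc m)) = refl
  Z≈Z₃ zero    (suc l) m             = refl
  Z≈Z₃ (suc k) l       m             = refl

  module Sxyz = ℤSolver Rxyz
  module Txyz = TermSemantics Rxyz
  open Txyz using (⟦_⟧ₜ)

  ρxyzab : Vec Ser 5
  ρxyzab = X₃ ∷ Y₃ ∷ Z₃ ∷ κ A ∷ κ B ∷ []

  vx vy vz va vb : ∀ {n} → Term (5 ℕ.+ n)
  vx = var (# 0)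
  vy = var (# 1)
  vz = var (# 2)
  va = var (# 3)
  vb = var (# 4)

  module PolynomialP {n : ℕ} (x y z a b : Term n) where
    bz Q T P : Term n
    bz = b :* z
    Q  = ((b :+ :- (x :* y)) :+ :- (y :* bz)) :+ :- (x :* bz)
    T  = ((x :* y) :* bz) :* (((x :+ y) :+ bz) :+ a)
    P  = Q :* Q :+ :- (con (+ 4) :* T)

  Pₜ : ∀ {n} → Term (5 ℕ.+ n)
  Pₜ = PolynomialP.P vx vy vz va vb

  κ-numeral : ∀ n → κ (ι n) Rxyz.≈ Sxyz.numeral n
  κ-numeral n = Rxyz.trans (κ-hom.⟦⟧-cong (sym (ℤSolver.numeral≈ι R n))) (φ-numeral κ-hom n)

  P≈⟦Pₜ⟧ : P[x,y,Bz] ≈ˢ ⟦ Pₜ ⟧ₜ ρxyzab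
  P≈⟦Pₜ⟧ = Rxyz.+-cong (⊛≈ Q≈ Q≈) (Rxyz.-‿cong (Rxyz.trans (•≈κ⊠ (ι 4) T) (Pxyz.⊠-cong (κ-numeral 4) T≈)))
    where
    module Pₜ = PolynomialP {5} vx vy vz va vb
    W Q T : Ser
    W = B • Z
    Q = ((cst B ⊖ (X ⊛ Y)) ⊖ (Y ⊛ W)) ⊖ (X ⊛ W)
    T = ((X ⊛ Y) ⊛ W) ⊛ (((X ⊕ Y) ⊕ W) ⊕ cst A)
    ⊛≈ : ∀ {F F′ G G′} → F ≈ˢ F′ → G ≈ˢ G′ → (F ⊛ G) ≈ˢ (F′ Pxyz.⊠ G′)
    ⊛≈ {F} {F′} {G} F≈ G≈ = Rxyz.trans (⊛≈⊠ F G) (Pxyz.⊠-cong F≈ G≈)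
    W≈ : W ≈ˢ ⟦ Pₜ.bz ⟧ₜ ρxyzab
    W≈ = Rxyz.trans (•≈κ⊠ B Z) (Pxyz.⊠-cong {κ B} Rxyz.refl Z≈Z₃)
    Q≈ : Q ≈ˢ ⟦ Pₜ.Q ⟧ₜ ρxyzab
    Q≈ = Rxyz.+-cong (Rxyz.+-cong (Rxyz.+-cong (cst≈κ B) (Rxyz.-‿cong (⊛≈ X≈X₃ Y≈Y₃))) (Rxyz.-‿cong (⊛≈ Y≈Y₃ W≈)))
                     (Rxyz.-‿cong (⊛≈ X≈X₃ W≈))
    T≈ : T ≈ˢ ⟦ Pₜ.T ⟧ₜ ρxyzab
    T≈ = ⊛≈ (⊛≈ (⊛≈ X≈X₃ Y≈Y₃) W≈) (Rxyz.+-cong (Rxyz.+-cong (Rxyz.+-cong X≈X₃ Y≈Y₃) W≈) (cst≈κ A))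

  -- The coefficientwise form of 𝓛ₓ F = 𝓛_z F.
  Recurrence : Ser → Set ℓ
  Recurrence F = ∀ k l m →
    B * (ι (suc k) * ι (suc k)) * F (suc k) l m + A * (ι k * ι (suc k)) * F k l m
      + 1# * (ι k * ι k) * Pxyz.shift F k l m
    ≈ 1# * (ι (suc m) * ι (suc m)) * F k l (suc m) + A * (ι m * ι (suc m)) * F k l m
      + B * (ι m * ι m) * Pz.shift (F k l) m

module DifferentialEquation {c ℓ : Level} (K : CharZeroField c ℓ) (A B : CharZeroField.Carrier K)
                        (hB : ¬ (CharZeroField._≈_ K B (CharZeroField.0# K))) where
  open CharZeroField K hiding (zero)
  open Setup K A B hB
  open TrivariateSeries K A B hB
  open Txyz using (⟦_⟧ₜ)

  ∂x ∂z : Derivation Rxyz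
  ∂x = Pxyz.∂-derivation
  ∂z = Pxyz.lift (Pyz.lift Pz.∂-derivation)
  module ∂x = Derivation ∂x
  module ∂z = Derivation ∂z

  ∂x-var ∂z-var : Fin 5 → Term 5
  ∂x-var Fin.zero    = con (+ 1)
  ∂x-var (Fin.suc _) = con (+ 0)
  ∂z-var (Fin.suc (Fin.suc Fin.zero)) = con (+ 1)
  ∂z-var _                            = con (+ 0)

  ∂x-vars : ∀ i → ∂x.d (lookup ρxyzab i) Rxyz.≈ ⟦ ∂x-var i ⟧ₜ ρxyzab
  ∂x-vars Fin.zero                                      = Pxyz.∂-X
  ∂x-vars (Fin.suc Fin.zero)                            = Pxyz.∂-const Pyz.X
  ∂x-vars (Fin.suc (Fin.suc Fin.zero))                  = Pxyz.∂-const (Pyz.const Pz.X)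
  ∂x-vars (Fin.suc (Fin.suc (Fin.suc Fin.zero)))        = Pxyz.∂-const (Pyz.const (Pz.const A))
  ∂x-vars (Fin.suc (Fin.suc (Fin.suc (Fin.suc Fin.zero)))) = Pxyz.∂-const (Pyz.const (Pz.const B))

  ∂z-const : ∀ (h : Rz.Carrier) → ∂z.d (constxyz.⟦ h ⟧) Rxyz.≈ constxyz.⟦ Pz.∂ h ⟧
  ∂z-const h = Rxyz.trans (Pxyz.lift-const (Pyz.lift Pz.∂-derivation) _)
                          (Pxyz.const-cong (Pyz.lift-const Pz.∂-derivation h))

  ∂z-vars : ∀ i → ∂z.d (lookup ρxyzab i) Rxyz.≈ ⟦ ∂z-var i ⟧ₜ ρxyzab
  ∂z-vars Fin.zero = Pxyz.lift-X (Pyz.lift Pz.∂-derivation)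
  ∂z-vars (Fin.suc Fin.zero) =
    Rxyz.trans (Pxyz.lift-const (Pyz.lift Pz.∂-derivation) _)
               (Rxyz.trans (Pxyz.const-cong (Pyz.lift-X Pz.∂-derivation)) Pxyz.const-0#)
  ∂z-vars (Fin.suc (Fin.suc Fin.zero)) = Rxyz.trans (∂z-const Pz.X) (constxyz.⟦⟧-cong Pz.∂-X)
  ∂z-vars (Fin.suc (Fin.suc (Fin.suc Fin.zero))) =
    Rxyz.trans (∂z-const _) (Rxyz.trans (constxyz.⟦⟧-cong (Pz.∂-const A)) constxyz.0#-homo)
  ∂z-vars (Fin.suc (Fin.suc (Fin.suc (Fin.suc Fin.zero)))) =
    Rxyz.trans (∂z-const _) (Rxyz.trans (constxyz.⟦⟧-cong (Pz.∂-const B)) constxyz.0#-homo)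

  Pxₜ Pxxₜ Pzₜ Pzzₜ : Term 5
  Pxₜ  = ∂ₜ ∂x-var Pₜ
  Pxxₜ = ∂ₜ ∂x-var Pxₜ
  Pzₜ  = ∂ₜ ∂z-var Pₜ
  Pzzₜ = ∂ₜ ∂z-var Pzₜ

  fₜ f′ₜ gₜ g′ₜ : ∀ {n} → Term (5 ℕ.+ n)
  fₜ  = vx :* vx :* vx :+ va :* vx :* vx :+ vb :* vx
  f′ₜ = con (+ 3) :* vx :* vx :+ con (+ 2) :* va :* vx :+ vb
  gₜ  = vb :* vz :* vz :* vz :+ va :* vz :* vz :+ vz
  g′ₜ = con (+ 3) :* vb :* vz :* vz :+ con (+ 2) :* va :* vz :+ con (+ 1)

  -- 4 P^{5/2} (𝓛ₓ − 𝓛_z) P^{-1/2}, where 𝓛ₓ = f ∂ₓ² + f′ ∂ₓ + x and 𝓛_z = g ∂_z² + g′ ∂_z + b z.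
  pdeₜ : ∀ {n} (p px pxx pz pzz : Term (5 ℕ.+ n)) → Term (5 ℕ.+ n)
  pdeₜ p px pxx pz pzz =
    fₜ :* (con (+ 3) :* px :* px :+ :- (con (+ 2) :* p :* pxx)) :+ :- (con (+ 2) :* f′ₜ :* p :* px)
    :+ con (+ 4) :* p :* p :* vx
    :+ :- (gₜ :* (con (+ 3) :* pz :* pz :+ :- (con (+ 2) :* p :* pzz))) :+ con (+ 2) :* g′ₜ :* p :* pz
    :+ :- (con (+ 4) :* p :* p :* vb :* vz)

  P-satisfies-pde : ⟦ pdeₜ Pₜ Pxₜ Pxxₜ Pzₜ Pzzₜ ⟧ₜ ρxyzab Rxyz.≈ Rxyz.0#
  P-satisfies-pde = Sxyz.prove ρxyzab (toExpr (pdeₜ Pₜ Pxₜ Pxxₜ Pzₜ Pzzₜ)) (toExpr (con (+ 0))) Rxyz.refl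

module SolutionRecurrence {c ℓ : Level} (K : CharZeroField c ℓ) (A B : CharZeroField.Carrier K)
                          (hB : ¬ (CharZeroField._≈_ K B (CharZeroField.0# K))) where
  open CharZeroField K hiding (zero)
  open Setup K A B hB
  open TrivariateSeries K A B hB
  open DifferentialEquation K A B hB
  open Txyz using (⟦_⟧ₜ; d-⟦⟧ₜ)
  open import Relation.Binary.Reasoning.Setoid setoid
  open import Algebra.Properties.Ring Rxyz.ring using (x∙y⁻¹≈ε⇒x≈y)

  module _ (S : Ser) (S²P≈1 : ((S ⊛ S) ⊛ P[x,y,Bz]) ≈ˢ cst 1#) where
    Sx Sxx Sz Szz P Px Pxx Pz Pzz : Ser
    Sx  = ∂x.d S
    Sxx = ∂x.d Sx
    Sz  = ∂z.d S
    Szz = ∂z.d Sz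
    P   = ⟦ Pₜ ⟧ₜ ρxyzab
    Px  = ⟦ Pxₜ ⟧ₜ ρxyzab
    Pxx = ⟦ Pxxₜ ⟧ₜ ρxyzab
    Pz  = ⟦ Pzₜ ⟧ₜ ρxyzab
    Pzz = ⟦ Pzzₜ ⟧ₜ ρxyzab

    ρ : Vec Ser 15
    ρ = X₃ ∷ Y₃ ∷ Z₃ ∷ κ A ∷ κ B ∷ S ∷ Sx ∷ Sxx ∷ Sz ∷ Szz ∷ P ∷ Px ∷ Pxx ∷ Pz ∷ Pzz ∷ []

    vs vsx vsxx vsz vszz vp vpx vpxx vpz vpzz : Term 15
    vs   = var (# 5)
    vsx  = var (# 6)
    vsxx = var (# 7)
    vsz  = var (# 8)
    vszz = var (# 9)
    vp   = var (# 10)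
    vpx  = var (# 11)
    vpxx = var (# 12)
    vpz  = var (# 13)
    vpzz = var (# 14)

    one : Term 15
    one = con (+ 1)

    𝓛ₓSₜ 𝓛zSₜ : Term 15
    𝓛ₓSₜ = (one :* (vx :* (vx :* vx)) :+ va :* (vx :* vx) :+ vb :* vx) :* vsxx
           :+ ((one :+ one :+ one) :* (vx :* vx) :+ (va :+ va) :* vx :+ vb) :* vsx :+ one :* (vx :* vs)
    𝓛zSₜ = (vb :* (vz :* (vz :* vz)) :+ va :* (vz :* vz) :+ one :* vz) :* vszz
           :+ ((vb :+ vb :+ vb) :* (vz :* vz) :+ (va :+ va) :* vz :+ one) :* vsz :+ vb :* (vz :* vs)

    uxₜ vxₜ uzₜ vzₜ : Term 15
    uxₜ = (vp :* vsx :+ vp :* vsx) :+ vpx :* vs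
    vxₜ = ((vpx :* vsx :+ vp :* vsxx) :+ (vpx :* vsx :+ vp :* vsxx)) :+ (vpxx :* vs :+ vpx :* vsx)
    uzₜ = (vp :* vsz :+ vp :* vsz) :+ vpz :* vs
    vzₜ = ((vpz :* vsz :+ vp :* vszz) :+ (vpz :* vsz :+ vp :* vszz)) :+ (vpzz :* vs :+ vpz :* vsz)

    -- 4 P² (𝓛ₓ − 𝓛_z) S is a combination of 2PS′ + P′S, its derivative (in x and in z) and the PDE of P.
    syzygyₜ : Term 15
    syzygyₜ = (con (+ 2) :* f′ₜ :* vp :+ :- (con (+ 3) :* fₜ :* vpx)) :* uxₜ
              :+ con (+ 2) :* fₜ :* vp :* vxₜ
              :+ :- (con (+ 2) :* g′ₜ :* vp :+ :- (con (+ 3) :* gₜ :* vpz)) :* uzₜ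
              :+ :- (con (+ 2) :* gₜ :* vp) :* vzₜ
              :+ vs :* pdeₜ vp vpx vpxx vpz vpzz

    syzygy : ⟦ con (+ 4) :* vp :* vp :* (𝓛ₓSₜ :+ :- 𝓛zSₜ) ⟧ₜ ρ Rxyz.≈ ⟦ syzygyₜ ⟧ₜ ρ
    syzygy = Sxyz.prove ρ (toExpr (con (+ 4) :* vp :* vp :* (𝓛ₓSₜ :+ :- 𝓛zSₜ))) (toExpr syzygyₜ) Rxyz.refl

    S²P≈1ₜ : (S Rxyz.* S) Rxyz.* P Rxyz.≈ Rxyz.1#
    S²P≈1ₜ = Rxyz.trans (Rxyz.sym (Rxyz.trans (⊛≈⊠ (S ⊛ S) P[x,y,Bz]) (Pxyz.⊠-cong (⊛≈⊠ S S) P≈⟦Pₜ⟧)))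
                        (Rxyz.trans S²P≈1 (Rxyz.trans (cst≈κ 1#) κ-hom.1#-homo))

    ux≈0 : ⟦ uxₜ ⟧ₜ ρ Rxyz.≈ Rxyz.0#
    ux≈0 = S²P≈1⇒2PS′+P′S≈0 ∂x S P Px S²P≈1ₜ (d-⟦⟧ₜ ∂x ∂x-var ρxyzab ∂x-vars Pₜ)

    vx≈0 : ⟦ vxₜ ⟧ₜ ρ Rxyz.≈ Rxyz.0#
    vx≈0 = d[2PS′+P′S]≈0 ∂x S P Px Pxx ux≈0 (d-⟦⟧ₜ ∂x ∂x-var ρxyzab ∂x-vars Pₜ)
                                            (d-⟦⟧ₜ ∂x ∂x-var ρxyzab ∂x-vars Pxₜ)

    uz≈0 : ⟦ uzₜ ⟧ₜ ρ Rxyz.≈ Rxyz.0#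
    uz≈0 = S²P≈1⇒2PS′+P′S≈0 ∂z S P Pz S²P≈1ₜ (d-⟦⟧ₜ ∂z ∂z-var ρxyzab ∂z-vars Pₜ)

    vz≈0 : ⟦ vzₜ ⟧ₜ ρ Rxyz.≈ Rxyz.0#
    vz≈0 = d[2PS′+P′S]≈0 ∂z S P Pz Pzz uz≈0 (d-⟦⟧ₜ ∂z ∂z-var ρxyzab ∂z-vars Pₜ)
                                            (d-⟦⟧ₜ ∂z ∂z-var ρxyzab ∂z-vars Pzₜ)

    syzygy≈0 : ⟦ syzygyₜ ⟧ₜ ρ Rxyz.≈ Rxyz.0#
    syzygy≈0 = Rxyz.trans (Rxyz.+-cong (Rxyz.+-cong (Rxyz.+-cong (Rxyz.+-cong (*0 ux≈0) (*0 vx≈0)) (*0 uz≈0)) (*0 vz≈0)) (*0 P-satisfies-pde))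
                 (Rxyz.trans (Rxyz.+-identityʳ _) (Rxyz.trans (Rxyz.+-identityʳ _)
                 (Rxyz.trans (Rxyz.+-identityʳ _) (Rxyz.+-identityʳ _))))
      where
      *0 : ∀ {a u} → u Rxyz.≈ Rxyz.0# → a Rxyz.* u Rxyz.≈ Rxyz.0#
      *0 {a} u≈0 = Rxyz.trans (Rxyz.*-congˡ u≈0) (Rxyz.zeroʳ a)

    ¼ : Ser
    ¼ = κ (inv (ι 4) (char0 3))

    ¼*4≈1 : ¼ Rxyz.* Sxyz.numeral 4 Rxyz.≈ Rxyz.1#
    ¼*4≈1 = Rxyz.trans (Rxyz.*-congˡ {¼} (Rxyz.sym (κ-numeral 4)))
              (Rxyz.trans (Rxyz.sym (κ-hom.*-homo _ _))
              (Rxyz.trans (κ-hom.⟦⟧-cong (trans (*-comm _ _) (inv-r (ι 4) (char0 3)))) κ-hom.1#-homo))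

    𝓛ₓS≈𝓛zS : ⟦ 𝓛ₓSₜ ⟧ₜ ρ Rxyz.≈ ⟦ 𝓛zSₜ ⟧ₜ ρ
    𝓛ₓS≈𝓛zS = x∙y⁻¹≈ε⇒x≈y _ _ (unit-cancel Rxyz ((Sxyz.numeral 4 Rxyz.* P) Rxyz.* P) (¼ Rxyz.* ((S Rxyz.* S) Rxyz.* (S Rxyz.* S))) (S²P≈1⇒fP²-invertible Rxyz S P (Sxyz.numeral 4) ¼ S²P≈1ₜ ¼*4≈1) (Rxyz.trans syzygy syzygy≈0))

    private
      module 𝓛ₓ = D2Operator Ryz
      module 𝓛z = D2Operator R
      module Tz = TermSemantics Rz

    ι-Ryz : ∀ n → ιᴿ Ryz n Ryz.≈ constyz.⟦ ι n ⟧
    ι-Ryz n = Ryz.trans (Pyz.ι-seriesRing n) (Pyz.const-cong (Pz.ι-seriesRing n))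

    constyz-scale : ∀ a i j (G : Ryz.Carrier) l m →
      ((constyz.⟦ a ⟧ Ryz.* (ιᴿ Ryz i Ryz.* ιᴿ Ryz j)) Ryz.* G) l m ≈ a * (ι i * ι j) * G l m
    constyz-scale a i j G l m = begin
      ((constyz.⟦ a ⟧ Ryz.* (ιᴿ Ryz i Ryz.* ιᴿ Ryz j)) Ryz.* G) l m
        ≈⟨ Ryz.*-congʳ {G} (Ryz.*-congˡ {constyz.⟦ a ⟧} (Ryz.*-cong (ι-Ryz i) (ι-Ryz j))) l m ⟩
      ((constyz.⟦ a ⟧ Ryz.* (constyz.⟦ ι i ⟧ Ryz.* constyz.⟦ ι j ⟧)) Ryz.* G) l m
        ≈⟨ Ryz.*-congʳ {G} (Ryz.trans (Ryz.*-congˡ {constyz.⟦ a ⟧} (Ryz.sym (constyz.*-homo _ _)))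
                                      (Ryz.sym (constyz.*-homo _ _))) l m ⟩
      (constyz.⟦ a * (ι i * ι j) ⟧ Ryz.* G) l m
        ≈⟨ constyz-⊠ _ G l m ⟩
      a * (ι i * ι j) * G l m
        ∎

    ρz : Vec Rz.Carrier 3
    ρz = Pz.X ∷ Pz.const A ∷ Pz.const B ∷ []

    gz g′z : Term 3
    gz  = var (# 2) :* (var (# 0) :* (var (# 0) :* var (# 0))) :+ var (# 1) :* (var (# 0) :* var (# 0))
          :+ con (+ 1) :* var (# 0)
    g′z = (var (# 2) :+ var (# 2) :+ var (# 2)) :* (var (# 0) :* var (# 0)) :+ (var (# 1) :+ var (# 1)) :* var (# 0)
          :+ con (+ 1)

    𝓛zS-coeff : ∀ k l → ⟦ 𝓛zSₜ ⟧ₜ ρ k l Rz.≈ 𝓛z.𝓛 1# A B (S k l)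
    𝓛zS-coeff k l = Rz.+-cong (Rz.+-cong (coefficient gz Szz) (coefficient g′z Sz))
                              (Rz.trans (constxyz-⊠ (Pz.const B) (Z₃ Rxyz.* S) k l)
                                        (Pz.⊠-cong {Pz.const B} Rz.refl (constxyz-⊠ Pz.X S k l)))
      where
      coefficient : ∀ t F → (⟦ t ⟧ₜ (map constxyz.⟦_⟧ ρz) Pxyz.⊠ F) k l Rz.≈ (Tz.⟦ t ⟧ₜ ρz Pz.⊠ F k l)
      coefficient t F = Rz.trans (Pxyz.⊠-cong {G = F} (Rxyz.sym (φ-⟦⟧ₜ constxyz ρz t)) Rxyz.refl k l)
                                 (constxyz-⊠ _ F k l)

    S-recurrence : Recurrence S
    S-recurrence k l m = begin
      B * (ι (suc k) * ι (suc k)) * S (suc k) l m + A * (ι k * ι (suc k)) * S k l m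
        + 1# * (ι k * ι k) * Pxyz.shift S k l m
        ≈⟨ sym (trans (𝓛ₓ.𝓛-coeff (constyz.⟦ B ⟧) (constyz.⟦ A ⟧) Ryz.1# S k l m)
                      (+-cong (+-cong (constyz-scale B (suc k) (suc k) (S (suc k)) l m)
                                      (constyz-scale A k (suc k) (S k) l m))
                              (constyz-scale 1# k k (Pxyz.shift S k) l m))) ⟩
      ⟦ 𝓛ₓSₜ ⟧ₜ ρ k l m
        ≈⟨ 𝓛ₓS≈𝓛zS k l m ⟩
      ⟦ 𝓛zSₜ ⟧ₜ ρ k l m
        ≈⟨ 𝓛zS-coeff k l m ⟩
      𝓛z.𝓛 1# A B (S k l) m
        ≈⟨ 𝓛z.𝓛-coeff 1# A B (S k l) m ⟩
      1# * (ι (suc m) * ι (suc m)) * S k l (suc m) + A * (ι m * ι (suc m)) * S k l m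
        + B * (ι m * ι m) * Pz.shift (S k l) m
        ∎

module RecurrenceSolutions {c ℓ : Level} (K : CharZeroField c ℓ) (A B : CharZeroField.Carrier K)
                           (hB : ¬ (CharZeroField._≈_ K B (CharZeroField.0# K))) where
  open CharZeroField K hiding (zero)
  open Setup K A B hB using (Ser; _≈ˢ_; _⊛_; P[x,y,Bz]; cst; _•_)
  open TrivariateSeries K A B hB
  open FieldProperties K
  open KroneckerDelta commRing
  open ℤSolver R using (solve; _⊜_)
  open Expression using (Κ; _⊕_; _⊗_; ⊝_)
  open import Relation.Binary.Reasoning.Setoid setoid
  open import Algebra.Properties.Ring ring using (+-cancelʳ; -0#≈0#)

  Recurrence-scale : ∀ F → Recurrence F → Recurrence (B • F)
  Recurrence-scale F rec k l m = begin
    b₁ * (B * F (suc k) l m) + a₁ * (B * F k l m) + c₁ * Pxyz.shift (B • F) k l m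
      ≈⟨ +-congˡ (*-congˡ (shift-x k)) ⟩
    b₁ * (B * F (suc k) l m) + a₁ * (B * F k l m) + c₁ * (B * Pxyz.shift F k l m)
      ≈⟨ factor-B _ _ _ _ _ _ ⟩
    B * (b₁ * F (suc k) l m + a₁ * F k l m + c₁ * Pxyz.shift F k l m)
      ≈⟨ *-congˡ (rec k l m) ⟩
    B * (b₂ * F k l (suc m) + a₂ * F k l m + c₂ * Pz.shift (F k l) m)
      ≈⟨ factor-B _ _ _ _ _ _ ⟨
    b₂ * (B * F k l (suc m)) + a₂ * (B * F k l m) + c₂ * (B * Pz.shift (F k l) m)
      ≈⟨ +-congˡ (*-congˡ (shift-z m)) ⟨
    b₂ * (B * F k l (suc m)) + a₂ * (B * F k l m) + c₂ * Pz.shift ((B • F) k l) m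
      ∎
    where
    b₁ a₁ c₁ b₂ a₂ c₂ : Carrier
    b₁ = B * (ι (suc k) * ι (suc k))
    a₁ = A * (ι k * ι (suc k))
    c₁ = 1# * (ι k * ι k)
    b₂ = 1# * (ι (suc m) * ι (suc m))
    a₂ = A * (ι m * ι (suc m))
    c₂ = B * (ι m * ι m)
    shift-x : ∀ k → Pxyz.shift (B • F) k l m ≈ B * Pxyz.shift F k l m
    shift-x zero    = sym (zeroʳ B)
    shift-x (suc k) = refl
    shift-z : ∀ m → Pz.shift ((B • F) k l) m ≈ B * Pz.shift (F k l) m
    shift-z zero    = sym (zeroʳ B)
    shift-z (suc m) = refl
    factor-B : ∀ p q r x y z → p * (B * x) + q * (B * y) + r * (B * z) ≈ B * (p * x + q * y + r * z)
    factor-B = solve 7 (λ b p q r x y z → p ⊗ (b ⊗ x) ⊕ q ⊗ (b ⊗ y) ⊕ r ⊗ (b ⊗ z) ⊜ b ⊗ (p ⊗ x ⊕ q ⊗ y ⊕ r ⊗ z)) refl B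

  -- The recurrence determines F (k + 1) from F k and F (k − 1), since B (k + 1)² ≠ 0.
  Recurrence-unique : ∀ {F G} → Recurrence F → Recurrence G → (∀ l m → F 0 l m ≈ G 0 l m) → F ≈ˢ G
  Recurrence-unique {F} {G} recF recG F₀≈G₀ k = proj₁ (agree k)
    where
    Agree : ℕ → Set ℓ
    Agree k = ∀ l m → F k l m ≈ G k l m
    next : ∀ k → (∀ l m → Pxyz.shift F k l m ≈ Pxyz.shift G k l m) → Agree k → Agree (suc k)
    next k shift≈ k≈ l m = *-cancelˡ-≉0 (*-≉0 hB (*-≉0 (char0 k) (char0 k))) (+-cancelʳ _ _ _ (+-cancelʳ _ _ _ (begin
      B * (ι (suc k) * ι (suc k)) * F (suc k) l m + A * (ι k * ι (suc k)) * F k l m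
        + 1# * (ι k * ι k) * Pxyz.shift F k l m
        ≈⟨ recF k l m ⟩
      1# * (ι (suc m) * ι (suc m)) * F k l (suc m) + A * (ι m * ι (suc m)) * F k l m
        + B * (ι m * ι m) * Pz.shift (F k l) m
        ≈⟨ +-cong (+-cong (*-congˡ (k≈ l (suc m))) (*-congˡ (k≈ l m))) (*-congˡ (shift-z m)) ⟩
      1# * (ι (suc m) * ι (suc m)) * G k l (suc m) + A * (ι m * ι (suc m)) * G k l m
        + B * (ι m * ι m) * Pz.shift (G k l) m
        ≈⟨ recG k l m ⟨
      B * (ι (suc k) * ι (suc k)) * G (suc k) l m + A * (ι k * ι (suc k)) * G k l m
        + 1# * (ι k * ι k) * Pxyz.shift G k l m
        ≈⟨ +-cong (+-congˡ (*-congˡ (k≈ l m))) (*-congˡ (shift≈ l m)) ⟨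
      B * (ι (suc k) * ι (suc k)) * G (suc k) l m + A * (ι k * ι (suc k)) * F k l m
        + 1# * (ι k * ι k) * Pxyz.shift F k l m
        ∎)))
      where
      shift-z : ∀ m → Pz.shift (F k l) m ≈ Pz.shift (G k l) m
      shift-z zero    = refl
      shift-z (suc m) = k≈ l m
    agree : ∀ k → Agree k × Agree (suc k)
    agree zero    = F₀≈G₀ , next 0 (λ l m → refl) F₀≈G₀
    agree (suc k) = proj₂ (agree k) , next (suc k) (proj₁ (agree k)) (proj₂ (agree k))

  open SolutionRecurrence K A B hB using (S²P≈1ₜ)

  module _ (S : Ser) (S²P≈1 : ((S ⊛ S) ⊛ P[x,y,Bz]) ≈ˢ cst 1#) (S₀₀₀≈B⁻¹ : S 0 0 0 ≈ inv B hB) where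
    private
      module Syz = ℤSolver Ryz
      module Tyz = TermSemantics Ryz

    y z b 1-yz : Ryz.Carrier
    y = Pyz.X
    z = Pyz.const Pz.X
    b = constyz.⟦ B ⟧
    1-yz = Ryz.1# Ryz.+ Ryz.- (y Ryz.* z)

    ρyzab : Vec Ryz.Carrier 4
    ρyzab = y ∷ z ∷ constyz.⟦ A ⟧ ∷ b ∷ []

    P₀ₜ : Term 4
    P₀ₜ = PolynomialP.P (con (+ 0)) (var (# 0)) (var (# 1)) (var (# 2)) (var (# 3))

    P₀≈b²[1-yz]² : Tyz.⟦ P₀ₜ ⟧ₜ ρyzab Ryz.≈ (b Ryz.* b) Ryz.* (1-yz Ryz.* 1-yz)
    P₀≈b²[1-yz]² = Syz.prove ρyzab (toExpr P₀ₜ)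
      (toExpr ((var (# 3) :* var (# 3)) :* ((con (+ 1) :+ :- (var (# 0) :* var (# 1))) :* (con (+ 1) :+ :- (var (# 0) :* var (# 1))))))
      Ryz.refl

    W : Ryz.Carrier
    W = (b Ryz.* S 0) Ryz.* 1-yz

    -- At x = 0 the equation S² P = 1 reads (b S₀ (1 − y z))² = 1.
    W²≈1 : W Ryz.* W Ryz.≈ Ryz.1#
    W²≈1 = Ryz.trans (Syz.solve 4 (λ s b y z → ((b ⊗ s) ⊗ (Κ (+ 1) ⊕ ⊝ (y ⊗ z))) ⊗ ((b ⊗ s) ⊗ (Κ (+ 1) ⊕ ⊝ (y ⊗ z)))
                                     Syz.⊜ (s ⊗ s) ⊗ ((b ⊗ b) ⊗ ((Κ (+ 1) ⊕ ⊝ (y ⊗ z)) ⊗ (Κ (+ 1) ⊕ ⊝ (y ⊗ z)))))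
                               Ryz.refl (S 0) b y z)
           (Ryz.trans (Ryz.*-congˡ {S 0 Ryz.* S 0} (Ryz.sym P₀≈b²[1-yz]²))
           (Ryz.trans (Ryz.*-congˡ {S 0 Ryz.* S 0} (Ryz.sym (φ-⟦⟧ₜ {R = Rxyz} {R′ = Ryz} Pxyz.coeff₀Hom ρxyzab (Pₜ {0}))))
                      (S²P≈1ₜ S S²P≈1 0)))

    ½*2≈1 : constyz.⟦ inv (ι 2) (char0 1) ⟧ Ryz.* Syz.numeral 2 Ryz.≈ Ryz.1#
    ½*2≈1 = Ryz.trans (Ryz.*-congˡ {constyz.⟦ inv (ι 2) (char0 1) ⟧}
                         (Ryz.sym (Ryz.trans (constyz.⟦⟧-cong (sym (ℤSolver.numeral≈ι R 2))) (φ-numeral {R = R} {R′ = Ryz} constyz 2))))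
              (Ryz.trans (Ryz.sym (constyz.*-homo _ _))
              (Ryz.trans (constyz.⟦⟧-cong (trans (*-comm _ _) (inv-r (ι 2) (char0 1)))) constyz.1#-homo))

    dW≈0 : ∀ (d : Derivation Ryz) → Derivation.d d W Ryz.≈ Ryz.0#
    dW≈0 d = W²≈1⇒dW≈0 d W _ ½*2≈1 W²≈1

    W≈1 : W Ryz.≈ Ryz.1#
    W≈1 zero    zero    = begin
      (B * S 0 0 0) * (1# + - (0# * 0#))   ≈⟨ *-cong (*-congˡ S₀₀₀≈B⁻¹) (trans (+-congˡ (trans (-‿cong (zeroˡ 0#)) -0#≈0#)) (+-identityʳ 1#)) ⟩
      (B * inv B hB) * 1#                   ≈⟨ trans (*-identityʳ _) (inv-r B hB) ⟩
      1#                                    ∎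
    W≈1 zero    (suc m) = *-zeroˡ-≉0 (char0 m) (dW≈0 (Pyz.lift Pz.∂-derivation) 0 m)
    W≈1 (suc l) m       = *-zeroˡ-≉0 (char0 l)
      (trans (sym (trans (Pz.⊠-cong {ιᴿ Rz (suc l)} {Pz.const (ι (suc l))} {W (suc l)} (Pz.ι-seriesRing (suc l)) Rz.refl m)
                         (Pz.const-⊠ (ι (suc l)) (W (suc l)) m)))
             (dW≈0 Pyz.∂-derivation l m))

    δ[1-yz]≈1 : δ Ryz.* 1-yz Ryz.≈ Ryz.1#
    δ[1-yz]≈1 = Ryz.trans (Syz.solve 3 (λ d y z → d ⊗ (Κ (+ 1) ⊕ ⊝ (y ⊗ z)) Syz.⊜ d ⊕ ⊝ (y ⊗ (z ⊗ d))) Ryz.refl δ y z)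
                  (Ryz.trans (Ryz.+-congˡ {δ} (Ryz.-‿cong (Ryz.trans (Pyz.X-⊠ (z Ryz.* δ))
                    (Pyz.shift-cong (λ l → Rz.trans (Pyz.const-⊠ Pz.X δ l) (Pz.X-⊠ (δ l)))))))
                  δ-δ[l-1][m-1]≈1)
      where
      δ-δ[l-1][m-1]≈1 : (δ Ryz.+ Ryz.- (Pyz.shift (λ l → Pz.shift (δ l)))) Ryz.≈ Ryz.1#
      δ-δ[l-1][m-1]≈1 zero    zero    = trans (+-congˡ -0#≈0#) (+-identityʳ _)
      δ-δ[l-1][m-1]≈1 zero    (suc m) = trans (+-congˡ -0#≈0#) (+-identityʳ _)
      δ-δ[l-1][m-1]≈1 (suc l) zero    = trans (+-congˡ -0#≈0#) (+-identityʳ _)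
      δ-δ[l-1][m-1]≈1 (suc l) (suc m) = -‿inverseʳ _

    bS₀≈δ : b Ryz.* S 0 Ryz.≈ δ
    bS₀≈δ = Ryz.trans (Ryz.sym (Ryz.trans (Ryz.*-congˡ {b Ryz.* S 0} δ[1-yz]≈1) (Ryz.*-identityʳ _)))
            (Ryz.trans (Syz.solve 3 (λ t d o → t ⊗ (d ⊗ o) Syz.⊜ d ⊗ (t ⊗ o)) Ryz.refl (b Ryz.* S 0) δ 1-yz)
            (Ryz.trans (Ryz.*-congˡ {δ} W≈1) (Ryz.*-identityʳ δ)))

    B•S-initial : ∀ l m → (B • S) 0 l m ≈ δ l m
    B•S-initial l m = trans (sym (constyz-⊠ B (S 0) l m)) (bS₀≈δ l m)

module StructureConstants {ℓ₁ ℓ₂ : Level} (K : CharZeroField ℓ₁ ℓ₂) (A B : CharZeroField.Carrier K)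
                          (hB : ¬ (CharZeroField._≈_ K B (CharZeroField.0# K))) where
  open CharZeroField K hiding (zero)
  open Setup K A B hB using (Poly; _≈ᴾ_; b; _·ᴾ_; IsStructConst)
  open BasisPolynomials K A B hB
  open TrivariateSeries K A B hB using (Recurrence; module Pxyz)
  open KroneckerDelta commRing
  open Pz using (Σ; Σ-cong≤; Σ-zero)
  open ℤSolver commRing using (ι-*)
  open Expression using (_⊕_; _⊗_)
  open import Relation.Binary.Reasoning.Setoid setoid
  private module Rz = CommutativeRing Pz.seriesRing

  module _ (cf : ℕ → ℕ → ℕ → Carrier) (isStructConst : IsStructConst cf) where
    private
      cf-vanish : ∀ k l m → k ℕ.+ l < m → cf k l m ≈ 0#
      cf-vanish = proj₁ isStructConst
      *0 : ∀ {a x} → x ≈ 0# → a * x ≈ 0#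
      *0 {a} x≈0 = trans (*-congˡ x≈0) (zeroʳ a)

    b⊠b : ∀ k l → (b k Pz.⊠ b l) ≈ᴾ combination (k ℕ.+ l) (cf k l)
    b⊠b k l j = trans (sym (Σ≤≈Σ j _)) (trans (proj₂ isStructConst k l j) (Σ≤≈Σ (k ℕ.+ l) _))

    b⊠b′ : ∀ k l → (b k Pz.⊠ b l) ≈ᴾ combination (suc (k ℕ.+ l)) (cf k l)
    b⊠b′ k l = Rz.trans (b⊠b k l) (Rz.sym (combination-extend _ (cf k l) (cf-vanish k l _ (ℕₚ.n<1+n _))))

    b-prev⊠b : ∀ k l → (b-prev k Pz.⊠ b l) ≈ᴾ combination (suc (k ℕ.+ l)) (Pxyz.shift cf k l)
    b-prev⊠b zero    l j = trans (Σ-zero j (λ i → zeroˡ _)) (sym (Σ-zero (suc l) (λ m → zeroˡ _)))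
    b-prev⊠b (suc k) l   = Rz.trans (b⊠b k l) (Rz.sym (Rz.trans
      (combination-extend _ (cf k l) (cf-vanish k l _ (ℕₚ.m<n⇒m<1+n (ℕₚ.n<1+n _))))
      (combination-extend _ (cf k l) (cf-vanish k l _ (ℕₚ.n<1+n _)))))

    -- the coordinates of (λ b_k) b_l
    λb⊠b-coordinates : ℕ → ℕ → ℕ → Carrier
    λb⊠b-coordinates k l m = (lead k * cf (suc k) l m + (A * ι (k ℕ.* suc k)) * cf k l m)
                             + ι (k ℕ.* k) * Pxyz.shift cf k l m

    -- λ (b_k b_l) computed as (λ b_k) b_l and as λ Σₘ c_klm bₘ
    λ[b⊠b] : ∀ k l → combination (suc (k ℕ.+ l)) (λb⊠b-coordinates k l)
                   ≈ᴾ combination (suc (k ℕ.+ l)) (λ-coordinates (cf k l))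
    λ[b⊠b] k l = Rz.trans (Rz.sym λb⊠b) (Rz.trans (Pz.⊠-assoc Pz.X (b k) (b l))
                   (Rz.trans (Pz.⊠-cong {Pz.X} Rz.refl (b⊠b k l)) (X⊠combination (k ℕ.+ l) (cf k l) (cf-vanish k l))))
      where
      module SRz = ℤSolver Pz.seriesRing
      N : ℕ
      N = suc (k ℕ.+ l)
      C₁ C₂ C₃ : Poly
      C₁ = Pz.const (lead k)
      C₂ = Pz.const (A * ι (k ℕ.* suc k))
      C₃ = Pz.const (ι (k ℕ.* k))
      λb⊠b : ((Pz.X Pz.⊠ b k) Pz.⊠ b l) ≈ᴾ combination (suc (k ℕ.+ l)) (λb⊠b-coordinates k l)
      λb⊠b = Rz.trans (Pz.⊠-cong {Pz.X Pz.⊠ b k} {_} {b l} (X⊠b k) Rz.refl)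
             (Rz.trans (SRz.solve 7 (λ c₁ c₂ c₃ x y z w → (c₁ ⊗ x ⊕ c₂ ⊗ y ⊕ c₃ ⊗ z) ⊗ w
                                      SRz.⊜ c₁ ⊗ (x ⊗ w) ⊕ c₂ ⊗ (y ⊗ w) ⊕ c₃ ⊗ (z ⊗ w))
                                   Rz.refl C₁ C₂ C₃ (b (suc k)) (b k) (b-prev k) (b l))
             (Rz.trans (Rz.+-cong (Rz.+-cong (Pz.⊠-cong {C₁} Rz.refl (b⊠b (suc k) l)) (Pz.⊠-cong {C₂} Rz.refl (b⊠b′ k l)))
                                  (Pz.⊠-cong {C₃} Rz.refl (b-prev⊠b k l)))
             (Rz.trans (Rz.+-cong (Rz.+-cong (const⊠combination N _ (cf (suc k) l)) (const⊠combination N _ (cf k l)))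
                                  (const⊠combination N _ (Pxyz.shift cf k l)))
             (Rz.trans (Rz.+-congʳ (combination-+ N _ _)) (combination-+ N _ _)))))

    structConst-recurrence : Recurrence cf
    structConst-recurrence k l m with m ℕₚ.≤? suc (k ℕ.+ l)
    ... | yes m≤N = begin
      B * (ι (suc k) * ι (suc k)) * cf (suc k) l m + A * (ι k * ι (suc k)) * cf k l m
        + 1# * (ι k * ι k) * Pxyz.shift cf k l m
        ≈⟨ +-cong (+-cong (*-congʳ (*-congˡ (sym (ι-* (suc k) (suc k))))) (*-congʳ (*-congˡ (sym (ι-* k (suc k))))))
                  (*-congʳ (trans (*-identityˡ _) (sym (ι-* k k)))) ⟩
      λb⊠b-coordinates k l m
        ≈⟨ combination-injective (suc (k ℕ.+ l)) _ _ (λ[b⊠b] k l) m m≤N ⟩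
      λ-coordinates (cf k l) m
        ∎
    ... | no m≰N = trans (three-terms≈0 (*0 (cf-vanish (suc k) l m N<m)) (*0 (cf-vanish k l m k+l<m)) (*0 (shift-x≈0 k N<m)))
                         (sym (three-terms≈0 (*0 (cf-vanish k l (suc m) (ℕₚ.<-trans k+l<m (ℕₚ.n<1+n m))))
                                             (*0 (cf-vanish k l m k+l<m)) (*0 (shift-z≈0 m N<m))))
      where
      N<m : suc (k ℕ.+ l) < m
      N<m = ℕₚ.≰⇒> m≰N
      k+l<m : k ℕ.+ l < m
      k+l<m = ℕₚ.<-trans (ℕₚ.n<1+n _) N<m
      three-terms≈0 : ∀ {x y z} → x ≈ 0# → y ≈ 0# → z ≈ 0# → x + y + z ≈ 0#
      three-terms≈0 x≈0 y≈0 z≈0 = trans (+-cong (+-cong x≈0 y≈0) z≈0) (trans (+-identityʳ _) (+-identityʳ _))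
      shift-x≈0 : ∀ k → suc (k ℕ.+ l) < m → Pxyz.shift cf k l m ≈ 0#
      shift-x≈0 zero     _   = refl
      shift-x≈0 (suc k′) N<m = cf-vanish k′ l m (ℕₚ.<-trans (ℕₚ.n<1+n _) (ℕₚ.<-trans (ℕₚ.n<1+n _) N<m))
      shift-z≈0 : ∀ m → suc (k ℕ.+ l) < m → Pz.shift (cf k l) m ≈ 0#
      shift-z≈0 (suc m′) (s≤s N≤m′) = cf-vanish k l m′ N≤m′

    structConst-initial : ∀ l m → cf 0 l m ≈ δ l m
    structConst-initial l m with m ℕₚ.≤? l
    ... | yes m≤l = combination-injective l (cf 0 l) (δ l)
                      (Rz.trans (Rz.sym (b⊠b 0 l)) (Rz.trans b₀⊠b≈b (Rz.sym combination-δ))) m m≤l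
      where
      b₀⊠b≈b : (b 0 Pz.⊠ b l) ≈ᴾ b l
      b₀⊠b≈b = Rz.trans (Pz.⊠-cong {b 0} {Pz.𝟙} {b l} b₀≈1 Rz.refl) (Pz.⊠-identityˡ (b l))
        where
        b₀≈1 : b 0 ≈ᴾ Pz.𝟙
        b₀≈1 zero    = refl
        b₀≈1 (suc j) = refl
      combination-δ : combination l (δ l) ≈ᴾ b l
      combination-δ j = δ-sum l
        where
        δ-sum : ∀ l → Σ l (λ m → δ l m * b m j) ≈ b l j
        δ-sum zero    = *-identityˡ _
        δ-sum (suc l) = trans (+-cong (trans (Σ-cong≤ l (λ m m≤l → trans (*-congʳ
                          (δ-off (suc l) m (λ m≡ → ℕₚ.<-irrefl m≡ (s≤s m≤l)))) (zeroˡ _))) (Σ-zero l (λ _ → refl)))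
                                      (trans (*-congʳ (δ-diag l)) (*-identityˡ _)))
                              (+-identityˡ _)
    ... | no m≰l = trans (cf-vanish 0 l m (ℕₚ.≰⇒> m≰l)) (sym (δ-off l m (λ m≡l → m≰l (ℕₚ.≤-reflexive m≡l))))

  structConst-exists : ∃ IsStructConst
  structConst-exists = (λ k l → coordinates (k ℕ.+ l) (b k ·ᴾ b l))
                     , (λ k l → coordinates-vanish (k ℕ.+ l) (b k ·ᴾ b l))
                     , (λ k l j → trans (expansion (k ℕ.+ l) (b k ·ᴾ b l) (product-degree k l) j) (sym (Σ≤≈Σ (k ℕ.+ l) _)))

  structConst-unique : ∀ cf cf′ → IsStructConst cf → IsStructConst cf′ → ∀ k l m → cf k l m ≈ cf′ k l m
  structConst-unique cf cf′ (vanish , expands) (vanish′ , expands′) k l m with m ℕₚ.≤? k ℕ.+ l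
  ... | yes m≤k+l = combination-injective (k ℕ.+ l) (cf k l) (cf′ k l) same m m≤k+l
    where
    same : combination (k ℕ.+ l) (cf k l) ≈ᴾ combination (k ℕ.+ l) (cf′ k l)
    same j = trans (sym (Σ≤≈Σ (k ℕ.+ l) _)) (trans (sym (expands k l j)) (trans (expands′ k l j) (Σ≤≈Σ (k ℕ.+ l) _)))
  ... | no m≰k+l = trans (vanish k l m (ℕₚ.≰⇒> m≰k+l)) (sym (vanish′ k l m (ℕₚ.≰⇒> m≰k+l)))

mainTheorem1 : {c ℓ : Level} (K : CharZeroField c ℓ)
    (A B : CharZeroField.Carrier K)
    (hB : ¬ (CharZeroField._≈_ K B (CharZeroField.0# K))) →
    let open CharZeroField K
        open Setup K A B hB
    in ((n : ℕ) → HasDegree (b n) n)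
       × (∃ λ cf → IsStructConst cf)
       × ((cf cf' : ℕ → ℕ → ℕ → Carrier) → IsStructConst cf → IsStructConst cf' →
            (k l m : ℕ) → cf k l m ≈ cf' k l m)
       × ((cf : ℕ → ℕ → ℕ → Carrier) (S : Ser) → IsStructConst cf →
            ((S ⊛ S) ⊛ P[x,y,Bz]) ≈ˢ cst 1# → S 0 0 0 ≈ inv B hB →
            (k l m : ℕ) → cf k l m ≈ B * S k l m)
mainTheorem1 K A B hB =
    b-degree
  , structConst-exists
  , structConst-unique
  , λ cf S isStructConst S²P≈1 S₀₀₀≈B⁻¹ →
      Recurrence-unique (structConst-recurrence cf isStructConst) (Recurrence-scale S (S-recurrence S S²P≈1))
        (λ l m → trans (structConst-initial cf isStructConst l m) (sym (B•S-initial S S²P≈1 S₀₀₀≈B⁻¹ l m)))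
  where
  open CharZeroField K using (trans; sym)
  open BasisPolynomials K A B hB using (b-degree)
  open StructureConstants K A B hB
  open SolutionRecurrence K A B hB using (S-recurrence)
  open RecurrenceSolutions K A B hB
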